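{- Let $z\ge1$ and let $\tau$ be a positive integer coprime to $P(z_0)$. If $z_0\ge24$, then for every positive integer $q$, $|G_\tau(z;z_0)w_q(z;z_0,\tau)|\le 1/q^{2/3}$. If $z_0\ge35$, then for every positive integer $q$, $|G_\tau(z;z_0)w_q(z;z_0,\tau)|\le1.04/q^{7/10}$.
   Context: $\mu$ is the Möbius function, $\varphi$ Euler's totient, $P(z_0)=\prod_{p<z_0}p$. For a positive integer $d$ and $y>0$, $G_d(y;z_0)=\sum_{\ell\le y,\,(\ell,dP(z_0))=1}\mu^2(\ell)/\varphi(\ell)$. Let $\varphi_2(n)=\prod_{p\mid n}(p-2)$. For squarefree $q$ and $y>0$, $\xi_q(y)=\sum_{q_1q_2q_3=q,\ q_1q_3\le y,\ q_2q_3\le y}\mu(q_3)\varphi_2(q_3)/\varphi(q_3)$, and $G_{[q]}(z;z_0,\tau)=\sum_{\ell\le z/\sqrt q,\,(\ell,q\tau P(z_0))=1}\frac{\mu^2(\ell)}{\varphi(\ell)}\xi_q(z/\ell)$. For $q$ squarefree and coprime to $\tau P(z_0)$, $w_q(z;z_0,\tau)=\frac{\mu(q)}{\varphi(q)G_\tau(z;z_0)}\cdot\frac{G_{[q]}(z;z_0,\tau)}{G_\tau(z;z_0)}$; for all other $q$, $w_q(z;z_0,\tau)=0$.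
   Formalization: The parameters z and z₀ range over the rationals instead of the reals. -}

module Defs where

open import Data.Bool using (Bool; true; false; if_then_else_; _∧_; not)
open import Data.Nat as ℕ using (ℕ; zero; suc)
open import Data.Nat.GCD using (gcd)
open import Data.Nat.Divisibility using (_∣?_)
open import Data.Nat.Primality using (prime?)
open import Data.Integer as ℤ using (+_)
open import Data.List using (List; map; filter; filterᵇ; length; foldr; concatMap)
open import Data.List.Base using (upTo)
open import Data.Rational as ℚ using (ℚ; 0ℚ; 1ℚ; _≤ᵇ_; _÷_)
open import Data.Rational.Properties using (_≟_)
open import Relation.Nullary.Decidable using (isYes; yes; no)

fromℕ : ℕ → ℚ
fromℕ n = + n ℚ./ 1

range : ℕ → List ℕ
range n = map suc (upTo n)

-- total rational division (x / 0 := 0; only ever used with nonzero divisors)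
divq : ℚ → ℚ → ℚ
divq p q with q ≟ 0ℚ
... | yes _ = 0ℚ
... | no q≢0 = _÷_ p q {{ℚ.≢-nonZero q≢0}}

powq : ℚ → ℕ → ℚ
powq x zero = 1ℚ
powq x (suc k) = x ℚ.* powq x k

sumq : List ℚ → ℚ
sumq = foldr ℚ._+_ 0ℚ

prodℕ : List ℕ → ℕ
prodℕ = foldr ℕ._*_ 1

primesUpTo : ℕ → List ℕ
primesUpTo n = filter prime? (range n)

primeDivisors : ℕ → List ℕ
primeDivisors n = filter (λ p → p ∣? n) (primesUpTo n)

coprimeᵇ : ℕ → ℕ → Bool
coprimeᵇ a b = gcd a b ℕ.≡ᵇ 1

squarefreeᵇ : ℕ → Bool
squarefreeᵇ zero = false
squarefreeᵇ n@(suc _) = foldr _∧_ true (map (λ p → not (isYes ((p ℕ.* p) ∣? n))) (primesUpTo n))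

-- Möbius function (μ(0) := 0, never used)
μ : ℕ → ℚ
μ n = if squarefreeᵇ n then powq (ℚ.- 1ℚ) (length (primeDivisors n)) else 0ℚ

φ : ℕ → ℕ
φ n = length (filter (λ k → gcd k n ℕ.≟ 1) (range n))

φ₂ : ℕ → ℚ
φ₂ n = foldr (λ p acc → (fromℕ p ℚ.- fromℕ 2) ℚ.* acc) 1ℚ (primeDivisors n)

-- ⌊y⌋ and ⌈y⌉ as naturals (absolute value; only used as enumeration bounds)
floorℕ : ℚ → ℕ
floorℕ y = ℤ.∣ ℚ.floor y ∣

ceilℕ : ℚ → ℕ
ceilℕ y = ℤ.∣ ℚ.ceiling y ∣

_<ᵇq_ : ℚ → ℚ → Bool
a <ᵇq b = not (b ≤ᵇ a)

P : ℚ → ℕ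
P z₀ = prodℕ (filterᵇ (λ p → isYes (prime? p) ∧ (fromℕ p <ᵇq z₀)) (range (ceilℕ z₀)))

h : ℕ → ℚ
h ℓ = divq (μ ℓ ℚ.* μ ℓ) (fromℕ (φ ℓ))

G : ℕ → ℚ → ℚ → ℚ
G d y z₀ = sumq (map h (filterᵇ (λ ℓ → (fromℕ ℓ ≤ᵇ y) ∧ coprimeᵇ ℓ (d ℕ.* P z₀)) (range (floorℕ y))))

ξ : ℕ → ℚ → ℚ
ξ q y =
  sumq (concatMap (λ q₁ → concatMap (λ q₂ → map (λ q₃ →
      if (q₁ ℕ.* q₂ ℕ.* q₃ ℕ.≡ᵇ q) ∧ (fromℕ (q₁ ℕ.* q₃) ≤ᵇ y) ∧ (fromℕ (q₂ ℕ.* q₃) ≤ᵇ y)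
      then divq (μ q₃ ℚ.* φ₂ q₃) (fromℕ (φ q₃))
      else 0ℚ) (range q)) (range q)) (range q))

-- G_[q](z; z₀, τ) = Σ_{ℓ ≤ z/√q, (ℓ, q τ P(z₀)) = 1} μ²(ℓ)/φ(ℓ) ξ_q(z/ℓ)
-- the condition ℓ ≤ z/√q is written as ℓ² q ≤ z² (equivalent for z > 0, ℓ, q ≥ 1)
Gbr : ℕ → ℚ → ℚ → ℕ → ℚ
Gbr q z z₀ τ =
  sumq (map (λ ℓ → h ℓ ℚ.* ξ q (divq z (fromℕ ℓ)))
    (filterᵇ (λ ℓ → (fromℕ (ℓ ℕ.* ℓ ℕ.* q) ≤ᵇ (z ℚ.* z)) ∧ coprimeᵇ ℓ (q ℕ.* τ ℕ.* P z₀))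
      (range (floorℕ z))))

w : ℕ → ℚ → ℚ → ℕ → ℚ
w q z z₀ τ =
  if squarefreeᵇ q ∧ coprimeᵇ q (τ ℕ.* P z₀)
  then divq (μ q) (fromℕ (φ q) ℚ.* G τ z z₀) ℚ.* divq (Gbr q z z₀ τ) (G τ z z₀)
  else 0ℚ

{-# OPTIONS --safe #-}
-- By definition G_τ w_q = μ(q) G_[q] / (φ(q) G_τ). Each ξ_q(z/ℓ) is bounded in absolute value by
-- Ξ(q) = Σ_{q = abc} |φ₂(c)|/φ(c), and the range of ℓ in G_[q] lies inside that of G_τ, so
-- |G_τ w_q| ≤ Ξ(q)/φ(q). The weight vanishes unless q is squarefree and coprime to P(z₀), so all
-- prime factors of q are at least z₀, and on such q the function Ξ/φ is multiplicative with value
-- (3p - 4)/(p - 1)² at a prime p. Both bounds therefore reduce to inequalities for single primes: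
-- (3p - 4)³ p² ≤ (p - 1)⁶ for p ≥ 29, and (3p - 4)¹⁰ p⁷ ≤ (p - 1)²⁰ for p ≥ 43, the primes 37 and 41
-- needing the extra factor 1.035¹⁰ · 1.001¹⁰ ≤ 1.04¹⁰.
module Submission where

-- An anonymous module keeps the unqualified ℕ operators imported here out of scope for the
-- statement of lemma13, which uses those of ℚ.
module _ where

  open import Algebra.Bundles using (CommutativeSemigroup)
  open import Algebra.Core using (Op₂)
  import Algebra.Properties.CommutativeSemigroup as CommutativeSemigroupProperties
  open import Algebra.Structures using (IsCommutativeMonoid)
  open import Data.Bool using (Bool; true; false; if_then_else_; T; T?; _∧_)
  open import Data.Bool.Properties using (T-∧)
  open import Data.Empty using (⊥; ⊥-elim)
  open import Data.Integer as ℤ using (+_; -[1+_])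
  import Data.Integer.Properties as ℤP
  open import Data.List using (List; []; _∷_; _++_; map; foldr; filter; filterᵇ; concatMap; length; applyUpTo)
  open import Data.List.Membership.Propositional using (_∈_)
  open import Data.List.Membership.Propositional.Properties using (∈-filter⁺; ∈-map⁺; ∈-upTo⁺)
  open import Data.List.Properties using (map-upTo; foldr-map)
  open import Data.List.Relation.Unary.All using (lookup)
  open import Data.List.Relation.Unary.All.Properties using (all⁺)
  open import Data.Nat as ℕ using (ℕ; zero; suc; _+_; _*_; _∸_; _^_; _≤_; _<_; s≤s; z≤n; NonZero)
  import Data.Nat.Coprimality as C
  open import Data.Nat.Divisibility
  open import Data.Nat.Divisibility.Core using (hasNonTrivialDivisor)
  import Data.Nat.DivMod as ℕ-DivMod
  open import Data.Nat.GCD using (gcd; gcd-greatest)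
  open import Data.Nat.Induction using (<-rec)
  open import Data.Nat.ListAction.Properties using (∈⇒∣product)
  open import Data.Nat.Primality
    using (Prime; prime?; ¬prime⇒composite; euclidsLemma; prime⇒irreducible; prime⇒nonZero; prime⇒nonTrivial)
  import Data.Nat.Properties as ℕP
  import Data.Nat.Solver as ℕ-Solver
  open import Data.Product using (_×_; _,_; proj₁; proj₂; ∃-syntax)
  open import Data.Rational as ℚ using (ℚ; mkℚ; 0ℚ; 1ℚ; ∣_∣; 1/_)
  open import Data.Rational.Properties using (_≟_)
  import Data.Rational.Properties as ℚP
  open import Data.Rational.Solver using (module +-*-Solver)
  open import Data.Sum using (_⊎_; inj₁; inj₂; [_,_]′)
  open import Data.Unit using (tt)
  open import Function using (_∘_; id)
  open import Function.Bundles using (mk⇔; Equivalence)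
  open import Level using (0ℓ)
  open import Relation.Binary.PropositionalEquality
  open import Relation.Nullary using (Dec; yes; no; does; ¬_; contradiction)
  open import Relation.Nullary.Decidable
    using (isYes; dec-true; dec-false; does-⇔; from-yes; from-no; fromWitness; toWitnessFalse)
  open import Relation.Unary using (Pred; Decidable)

  open import Defs

  -- Finite sums and products over 1, …, n

  module BigOperator {A : Set} {_∙_ : Op₂ A} {ε : A}
    (isCommutativeMonoid : IsCommutativeMonoid _≡_ _∙_ ε) where

    open IsCommutativeMonoid isCommutativeMonoid using (assoc; identityˡ; identityʳ; isCommutativeSemigroup)

    private
      commutativeSemigroup : CommutativeSemigroup 0ℓ 0ℓ
      commutativeSemigroup = record { isCommutativeSemigroup = isCommutativeSemigroup }

    open CommutativeSemigroupProperties commutativeSemigroup using (interchange)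

    ⨁ : (ℕ → A) → ℕ → A
    ⨁ f zero = ε
    ⨁ f (suc n) = f 1 ∙ ⨁ (f ∘ suc) n

    ⨁-rel : (R : A → A → Set) → R ε ε → (∀ {x y u v} → R x y → R u v → R (x ∙ u) (y ∙ v)) →
      ∀ {f g} n → (∀ k → 1 ≤ k → k ≤ n → R (f k) (g k)) → R (⨁ f n) (⨁ g n)
    ⨁-rel R Rε R∙ zero _ = Rε
    ⨁-rel R Rε R∙ (suc n) fRg =
      R∙ (fRg 1 (s≤s z≤n) (s≤s z≤n)) (⨁-rel R Rε R∙ n (λ k 1≤k k≤n → fRg (suc k) (s≤s z≤n) (s≤s k≤n)))

    ⨁-cong : ∀ {f g} n → (∀ k → 1 ≤ k → k ≤ n → f k ≡ g k) → ⨁ f n ≡ ⨁ g n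
    ⨁-cong = ⨁-rel _≡_ refl (cong₂ _∙_)

    ⨁-ε : ∀ f n → (∀ k → 1 ≤ k → k ≤ n → f k ≡ ε) → ⨁ f n ≡ ε
    ⨁-ε f zero _ = refl
    ⨁-ε f (suc n) f≡ε = trans
      (cong₂ _∙_ (f≡ε 1 (s≤s z≤n) (s≤s z≤n)) (⨁-ε (f ∘ suc) n (λ k 1≤k k≤n → f≡ε (suc k) (s≤s z≤n) (s≤s k≤n))))
      (identityˡ ε)

    ⨁-split : ∀ f m n → ⨁ f (m + n) ≡ ⨁ f m ∙ ⨁ (λ k → f (m + k)) n
    ⨁-split f zero n = sym (identityˡ _)
    ⨁-split f (suc m) n = trans (cong (f 1 ∙_) (⨁-split (f ∘ suc) m n)) (sym (assoc _ _ _))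

    ⨁-∙ : ∀ f g n → ⨁ (λ k → f k ∙ g k) n ≡ ⨁ f n ∙ ⨁ g n
    ⨁-∙ f g zero = sym (identityˡ ε)
    ⨁-∙ f g (suc n) =
      trans (cong ((f 1 ∙ g 1) ∙_) (⨁-∙ (f ∘ suc) (g ∘ suc) n)) (interchange _ _ _ _)

    ⨁-swap : ∀ (f : ℕ → ℕ → A) m n → ⨁ (λ i → ⨁ (f i) n) m ≡ ⨁ (λ j → ⨁ (λ i → f i j) m) n
    ⨁-swap f zero n = sym (⨁-ε (λ _ → ε) n (λ _ _ _ → refl))
    ⨁-swap f (suc m) n =
      trans (cong (⨁ (f 1) n ∙_) (⨁-swap (f ∘ suc) m n)) (sym (⨁-∙ (f 1) (λ j → ⨁ (λ i → f (suc i) j) m) n))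

    ⨁-single : ∀ f n j → 1 ≤ j → j ≤ n → (∀ k → 1 ≤ k → k ≤ n → k ≢ j → f k ≡ ε) → ⨁ f n ≡ f j
    ⨁-single f (suc n) (suc zero) _ _ off =
      trans (cong (f 1 ∙_) (⨁-ε (f ∘ suc) n (λ k 1≤k k≤n → off (suc k) (s≤s z≤n) (s≤s k≤n) (1+k≢1 1≤k))))
            (identityʳ (f 1))
      where
      1+k≢1 : ∀ {k} → 1 ≤ k → suc k ≢ 1
      1+k≢1 1≤k refl = ℕP.n≮0 1≤k
    ⨁-single f (suc n) (suc (suc j)) _ (s≤s j<n) off =
      trans (cong₂ _∙_ (off 1 (s≤s z≤n) (s≤s z≤n) (λ ()))
                       (⨁-single (f ∘ suc) n (suc j) (s≤s z≤n) j<n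
                          (λ k 1≤k k≤n k≢j → off (suc k) (s≤s z≤n) (s≤s k≤n) (k≢j ∘ ℕP.suc-injective))))
            (identityˡ _)

    ⨁-truncate : ∀ f {m n} → m ≤ n → (∀ k → m < k → k ≤ n → f k ≡ ε) → ⨁ f n ≡ ⨁ f m
    ⨁-truncate f {n = n} z≤n outside = ⨁-ε f n outside
    ⨁-truncate f (s≤s m≤n) outside =
      cong (f 1 ∙_) (⨁-truncate (f ∘ suc) m≤n (λ k m<k k≤n → outside (suc k) (s≤s m<k) (s≤s k≤n)))

    foldr-map-applyUpTo : ∀ (f : ℕ → A) (g : ℕ → ℕ) n → foldr _∙_ ε (map f (applyUpTo (g ∘ suc) n)) ≡ ⨁ (f ∘ g) n
    foldr-map-applyUpTo f g zero = refl
    foldr-map-applyUpTo f g (suc n) = cong (f (g 1) ∙_) (foldr-map-applyUpTo f (g ∘ suc) n)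

    foldr-map-range : ∀ (f : ℕ → A) n → foldr _∙_ ε (map f (range n)) ≡ ⨁ f n
    foldr-map-range f n = trans (cong (λ xs → foldr _∙_ ε (map f xs)) (map-upTo suc n)) (foldr-map-applyUpTo f id n)

  open BigOperator ℚP.+-0-isCommutativeMonoid
    renaming (⨁ to ∑; ⨁-rel to ∑-rel; ⨁-cong to ∑-cong; ⨁-ε to ∑-0; ⨁-split to ∑-split; ⨁-∙ to ∑-+;
              ⨁-swap to ∑-swap; ⨁-single to ∑-single; ⨁-truncate to ∑-truncate; foldr-map-range to foldr-+-range)
    hiding (foldr-map-applyUpTo)
  open BigOperator ℚP.*-1-isCommutativeMonoid
    renaming (⨁ to ∏; ⨁-cong to ∏-cong; ⨁-∙ to ∏-*; ⨁-single to ∏-single; ⨁-truncate to ∏-truncate;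
              foldr-map-range to foldr-*-range)
    hiding (⨁-rel; ⨁-ε; ⨁-split; ⨁-swap; foldr-map-applyUpTo)

  -- Rational arithmetic

  ≤∧≢⇒< : ∀ {p q} → p ℚ.≤ q → p ≢ q → p ℚ.< q
  ≤∧≢⇒< p≤q p≢q = ℚP.≰⇒> (λ q≤p → p≢q (ℚP.≤-antisym p≤q q≤p))

  fromℕ≡mkℚ : ∀ n → fromℕ n ≡ mkℚ (+ n) 0 (C.sym (C.1-coprimeTo n))
  fromℕ≡mkℚ n = ℚP.normalize-coprime (C.sym (C.1-coprimeTo n))

  fromℕ-+ : ∀ m n → fromℕ (m + n) ≡ fromℕ m ℚ.+ fromℕ n
  fromℕ-+ m n = sym (trans (cong₂ ℚ._+_ (fromℕ≡mkℚ m) (fromℕ≡mkℚ n))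
    (ℚP./-cong {p₁ = + m ℤ.* + 1 ℤ.+ + n ℤ.* + 1} {q₁ = 1}
      (cong₂ ℤ._+_ (ℤP.*-identityʳ (+ m)) (ℤP.*-identityʳ (+ n))) refl))

  fromℕ-* : ∀ m n → fromℕ (m * n) ≡ fromℕ m ℚ.* fromℕ n
  fromℕ-* m n = sym (trans (cong₂ ℚ._*_ (fromℕ≡mkℚ m) (fromℕ≡mkℚ n))
    (ℚP./-cong {p₁ = + m ℤ.* + n} {q₁ = 1} (sym (ℤP.pos-* m n)) refl))

  0≤fromℕ : ∀ n → 0ℚ ℚ.≤ fromℕ n
  0≤fromℕ n = ℚP.nonNegative⁻¹ (fromℕ n) {{ℚP.normalize-nonNeg n 1}}

  0<fromℕ : ∀ n .{{_ : NonZero n}} → 0ℚ ℚ.< fromℕ n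
  0<fromℕ n = ℚP.positive⁻¹ (fromℕ n) {{ℚP.normalize-pos n 1}}

  fromℕ-mono-≤ : ∀ {m n} → m ≤ n → fromℕ m ℚ.≤ fromℕ n
  fromℕ-mono-≤ {m} {n} m≤n = begin
    fromℕ m                       ≡⟨ ℚP.+-identityʳ (fromℕ m) ⟨
    fromℕ m ℚ.+ 0ℚ                ≤⟨ ℚP.+-monoʳ-≤ (fromℕ m) (0≤fromℕ (n ∸ m)) ⟩
    fromℕ m ℚ.+ fromℕ (n ∸ m)     ≡⟨ fromℕ-+ m (n ∸ m) ⟨
    fromℕ (m + (n ∸ m))           ≡⟨ cong fromℕ (ℕP.m+[n∸m]≡n m≤n) ⟩
    fromℕ n                       ∎
    where open ℚP.≤-Reasoning

  fromℕ-injective : ∀ {m n} → fromℕ m ≡ fromℕ n → m ≡ n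
  fromℕ-injective {m} {n} eq = ℤP.+-injective (cong ℚ.↥_ (trans (sym (fromℕ≡mkℚ m)) (trans eq (fromℕ≡mkℚ n))))

  fromℕ-mono-< : ∀ {m n} → m < n → fromℕ m ℚ.< fromℕ n
  fromℕ-mono-< {m} {n} m<n = ≤∧≢⇒< (fromℕ-mono-≤ (ℕP.<⇒≤ m<n)) (ℕP.<⇒≢ m<n ∘ fromℕ-injective)

  *-nonneg : ∀ {p q} → 0ℚ ℚ.≤ p → 0ℚ ℚ.≤ q → 0ℚ ℚ.≤ p ℚ.* q
  *-nonneg {p} {q} 0≤p 0≤q =
    ℚP.nonNegative⁻¹ _ {{ℚP.nonNeg*nonNeg⇒nonNeg p {{ℚ.nonNegative 0≤p}} q {{ℚ.nonNegative 0≤q}}}}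

  square-nonneg : ∀ p → 0ℚ ℚ.≤ p ℚ.* p
  square-nonneg p with ℚP.≤-total 0ℚ p
  ... | inj₁ 0≤p = *-nonneg 0≤p 0≤p
  ... | inj₂ p≤0 = ℚP.nonNegative⁻¹ _ {{ℚP.nonPos*nonPos⇒nonPos p {{ℚ.nonPositive p≤0}} p {{ℚ.nonPositive p≤0}}}}

  *-monoˡ-≤-nonneg : ∀ {r p q} → 0ℚ ℚ.≤ r → p ℚ.≤ q → r ℚ.* p ℚ.≤ r ℚ.* q
  *-monoˡ-≤-nonneg {r} 0≤r = ℚP.*-monoˡ-≤-nonNeg r {{ℚ.nonNegative 0≤r}}

  *-monoʳ-≤-nonneg : ∀ {r p q} → 0ℚ ℚ.≤ r → p ℚ.≤ q → p ℚ.* r ℚ.≤ q ℚ.* r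
  *-monoʳ-≤-nonneg {r} 0≤r = ℚP.*-monoʳ-≤-nonNeg r {{ℚ.nonNegative 0≤r}}

  powq-* : ∀ p q n → powq (p ℚ.* q) n ≡ powq p n ℚ.* powq q n
  powq-* p q zero = refl
  powq-* p q (suc n) = trans (cong ((p ℚ.* q) ℚ.*_) (powq-* p q n))
    (solve 4 (λ p q x y → (p :* q) :* (x :* y) := (p :* x) :* (q :* y)) refl p q (powq p n) (powq q n))
    where open +-*-Solver

  powq-fromℕ : ∀ m n → powq (fromℕ m) n ≡ fromℕ (m ^ n)
  powq-fromℕ m zero = refl
  powq-fromℕ m (suc n) = trans (cong (fromℕ m ℚ.*_) (powq-fromℕ m n)) (sym (fromℕ-* m (m ^ n)))

  powq-nonneg : ∀ {p} n → 0ℚ ℚ.≤ p → 0ℚ ℚ.≤ powq p n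
  powq-nonneg zero _ = ℚP.≤ᵇ⇒≤ tt
  powq-nonneg (suc n) 0≤p = *-nonneg 0≤p (powq-nonneg n 0≤p)

  powq-pos : ∀ {p} n → 0ℚ ℚ.< p → 0ℚ ℚ.< powq p n
  powq-pos zero _ = ℚP.positive⁻¹ 1ℚ
  powq-pos {p} (suc n) 0<p =
    ℚP.positive⁻¹ _ {{ℚP.pos*pos⇒pos p {{ℚ.positive 0<p}} (powq p n) {{ℚ.positive (powq-pos n 0<p)}}}}

  powq-mono-≤ : ∀ {p q} n → 0ℚ ℚ.≤ p → p ℚ.≤ q → powq p n ℚ.≤ powq q n
  powq-mono-≤ zero _ _ = ℚP.≤-refl
  powq-mono-≤ (suc n) 0≤p p≤q = ℚP.≤-trans (*-monoʳ-≤-nonneg (powq-nonneg n 0≤p) p≤q)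
    (*-monoˡ-≤-nonneg (ℚP.≤-trans 0≤p p≤q) (powq-mono-≤ n 0≤p p≤q))

  powq-1 : ∀ n → powq 1ℚ n ≡ 1ℚ
  powq-1 zero = refl
  powq-1 (suc n) = trans (ℚP.*-identityˡ (powq 1ℚ n)) (powq-1 n)

  divq-*-cancel : ∀ p q → q ≢ 0ℚ → divq p q ℚ.* q ≡ p
  divq-*-cancel p q q≢0 with q ≟ 0ℚ
  ... | yes q≡0 = ⊥-elim (q≢0 q≡0)
  ... | no q≢0′ = trans (ℚP.*-assoc p (1/ q) q) (trans (cong (p ℚ.*_) (ℚP.*-inverseˡ q)) (ℚP.*-identityʳ p))
    where instance _ = ℚ.≢-nonZero q≢0′

  *-divq-cancel : ∀ p q → q ≢ 0ℚ → divq (p ℚ.* q) q ≡ p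
  *-divq-cancel p q q≢0 with q ≟ 0ℚ
  ... | yes q≡0 = ⊥-elim (q≢0 q≡0)
  ... | no q≢0′ = trans (ℚP.*-assoc p q (1/ q)) (trans (cong (p ℚ.*_) (ℚP.*-inverseʳ q)) (ℚP.*-identityʳ p))
    where instance _ = ℚ.≢-nonZero q≢0′

  *-cancelʳ-≡ : ∀ {p q} r → r ≢ 0ℚ → p ℚ.* r ≡ q ℚ.* r → p ≡ q
  *-cancelʳ-≡ {p} {q} r r≢0 eq =
    trans (sym (*-divq-cancel p r r≢0)) (trans (cong (λ x → divq x r) eq) (*-divq-cancel q r r≢0))

  divq-nonneg : ∀ {p q} → 0ℚ ℚ.≤ p → 0ℚ ℚ.≤ q → 0ℚ ℚ.≤ divq p q
  divq-nonneg {p} {q} 0≤p 0≤q = by-cases (q ≟ 0ℚ)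
    where
    by-cases : Dec (q ≡ 0ℚ) → 0ℚ ℚ.≤ divq p q
    by-cases (yes q≡0) = subst (λ q → 0ℚ ℚ.≤ divq p q) (sym q≡0) ℚP.≤-refl
    by-cases (no q≢0) = ℚP.*-cancelʳ-≤-pos q {{ℚ.positive (≤∧≢⇒< 0≤q (q≢0 ∘ sym))}}
      (subst₂ ℚ._≤_ (sym (ℚP.*-zeroˡ q)) (sym (divq-*-cancel p q q≢0)) 0≤p)

  ∣divq∣≤divq : ∀ {p r} q → 0ℚ ℚ.≤ q → ∣ p ∣ ℚ.≤ r → ∣ divq p q ∣ ℚ.≤ divq r q
  ∣divq∣≤divq {p} {r} q 0≤q ∣p∣≤r = by-cases (q ≟ 0ℚ)
    where
    by-cases : Dec (q ≡ 0ℚ) → ∣ divq p q ∣ ℚ.≤ divq r q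
    by-cases (yes q≡0) = subst (λ q → ∣ divq p q ∣ ℚ.≤ divq r q) (sym q≡0) ℚP.≤-refl
    by-cases (no q≢0) = ℚP.*-cancelʳ-≤-pos q {{ℚ.positive (≤∧≢⇒< 0≤q (q≢0 ∘ sym))}} (begin
      ∣ divq p q ∣ ℚ.* q        ≡⟨ cong (∣ divq p q ∣ ℚ.*_) (ℚP.0≤p⇒∣p∣≡p 0≤q) ⟨
      ∣ divq p q ∣ ℚ.* ∣ q ∣    ≡⟨ ℚP.∣p*q∣≡∣p∣*∣q∣ (divq p q) q ⟨
      ∣ divq p q ℚ.* q ∣        ≡⟨ cong ∣_∣ (divq-*-cancel p q q≢0) ⟩
      ∣ p ∣                     ≤⟨ ∣p∣≤r ⟩
      r                         ≡⟨ divq-*-cancel r q q≢0 ⟨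
      divq r q ℚ.* q            ∎)
      where open ℚP.≤-Reasoning

  sumq-filterᵇ : ∀ {A : Set} (p : A → Bool) (f : A → ℚ) xs →
    sumq (map f (filterᵇ p xs)) ≡ sumq (map (λ x → if p x then f x else 0ℚ) xs)
  sumq-filterᵇ p f [] = refl
  sumq-filterᵇ p f (x ∷ xs) with p x
  ... | true = cong (f x ℚ.+_) (sumq-filterᵇ p f xs)
  ... | false = trans (sumq-filterᵇ p f xs) (sym (ℚP.+-identityˡ _))

  sumq-++ : ∀ xs ys → sumq (xs ++ ys) ≡ sumq xs ℚ.+ sumq ys
  sumq-++ [] ys = sym (ℚP.+-identityˡ (sumq ys))
  sumq-++ (x ∷ xs) ys = trans (cong (x ℚ.+_) (sumq-++ xs ys)) (sym (ℚP.+-assoc x (sumq xs) (sumq ys)))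

  sumq-concatMap : ∀ {A : Set} (g : A → List ℚ) xs → sumq (concatMap g xs) ≡ sumq (map (sumq ∘ g) xs)
  sumq-concatMap g [] = refl
  sumq-concatMap g (x ∷ xs) = trans (sumq-++ (g x) (concatMap g xs)) (cong (sumq (g x) ℚ.+_) (sumq-concatMap g xs))

  fromℕ-length-filter : ∀ {A : Set} {P : Pred A 0ℓ} (P? : Decidable P) xs →
    fromℕ (length (filter P? xs)) ≡ sumq (map (λ x → if does (P? x) then 1ℚ else 0ℚ) xs)
  fromℕ-length-filter P? [] = refl
  fromℕ-length-filter P? (x ∷ xs) with does (P? x)
  ... | true = trans (fromℕ-+ 1 (length (filter P? xs))) (cong (1ℚ ℚ.+_) (fromℕ-length-filter P? xs))
  ... | false = trans (fromℕ-length-filter P? xs) (sym (ℚP.+-identityˡ _))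

  productq-filter : ∀ {A : Set} {P : Pred A 0ℓ} (P? : Decidable P) (g : A → ℚ) xs →
    foldr ℚ._*_ 1ℚ (map g (filter P? xs)) ≡ foldr ℚ._*_ 1ℚ (map (λ x → if does (P? x) then g x else 1ℚ) xs)
  productq-filter P? g [] = refl
  productq-filter P? g (x ∷ xs) with does (P? x)
  ... | true = cong (g x ℚ.*_) (productq-filter P? g xs)
  ... | false = trans (productq-filter P? g xs) (sym (ℚP.*-identityˡ _))

  ∑-scale : ∀ r f n → ∑ (λ k → r ℚ.* f k) n ≡ r ℚ.* ∑ f n
  ∑-scale r f zero = sym (ℚP.*-zeroʳ r)
  ∑-scale r f (suc n) = trans (cong (r ℚ.* f 1 ℚ.+_) (∑-scale r (f ∘ suc) n)) (sym (ℚP.*-distribˡ-+ r (f 1) _))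

  ∑-nonneg : ∀ {f} n → (∀ k → 1 ≤ k → k ≤ n → 0ℚ ℚ.≤ f k) → 0ℚ ℚ.≤ ∑ f n
  ∑-nonneg {f} = ∑-rel (λ _ y → 0ℚ ℚ.≤ y) ℚP.≤-refl ℚP.+-mono-≤ {f} {f}

  ∣∑∣≤∑ : ∀ {f g} n → (∀ k → 1 ≤ k → k ≤ n → ∣ f k ∣ ℚ.≤ g k) → ∣ ∑ f n ∣ ℚ.≤ ∑ g n
  ∣∑∣≤∑ = ∑-rel (λ x y → ∣ x ∣ ℚ.≤ y) ℚP.≤-refl
    (λ {x} {_} {u} x≤y u≤v → ℚP.≤-trans (ℚP.∣p+q∣≤∣p∣+∣q∣ x u) (ℚP.+-mono-≤ x≤y u≤v))

  if-does-yes : ∀ {P X : Set} (P? : Dec P) {x y : X} → P → (if does P? then x else y) ≡ x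
  if-does-yes P? {x} {y} p = cong (if_then x else y) (dec-true P? p)

  if-does-no : ∀ {P X : Set} (P? : Dec P) {x y : X} → ¬ P → (if does P? then x else y) ≡ y
  if-does-no P? {x} {y} ¬p = cong (if_then x else y) (dec-false P? ¬p)

  ∑-multiples : ∀ p .{{_ : NonZero p}} (F : ℕ → ℚ) m →
    ∑ (λ a → if does (p ∣? a) then F a else 0ℚ) (p * m) ≡ ∑ (λ a → F (p * a)) m
  ∑-multiples p F zero = cong (∑ _) (ℕP.*-zeroʳ p)
  ∑-multiples p F (suc m) = begin
    ∑ f (p * suc m)
      ≡⟨ cong (∑ f) (ℕP.*-suc p m) ⟩
    ∑ f (p + p * m)
      ≡⟨ ∑-split f p (p * m) ⟩
    ∑ f p ℚ.+ ∑ (λ k → f (p + k)) (p * m)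
      ≡⟨ cong₂ ℚ._+_ ∑f[p]≡Fp (∑-cong (p * m) (λ k _ _ → shift k)) ⟩
    F p ℚ.+ ∑ (λ k → if does (p ∣? k) then F (p + k) else 0ℚ) (p * m)
      ≡⟨ cong₂ ℚ._+_ (cong F (sym (ℕP.*-identityʳ p)))
                     (∑-multiples p (λ k → F (p + k)) m) ⟩
    F (p * 1) ℚ.+ ∑ (λ a → F (p + p * a)) m
      ≡⟨ cong (F (p * 1) ℚ.+_) (∑-cong m (λ a _ _ → cong F (sym (ℕP.*-suc p a)))) ⟩
    ∑ (λ a → F (p * a)) (suc m)
      ∎
    where
    open ≡-Reasoning
    f : ℕ → ℚ
    f a = if does (p ∣? a) then F a else 0ℚ
    ∑f[p]≡Fp : ∑ f p ≡ F p
    ∑f[p]≡Fp = trans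
      (∑-single f p p (ℕ.>-nonZero⁻¹ p) ℕP.≤-refl (λ k 1≤k k≤p k≢p →
        if-does-no (p ∣? k) (ℕP.<⇒≱ (ℕP.≤∧≢⇒< k≤p k≢p) ∘ ∣⇒≤ {{ℕ.>-nonZero 1≤k}})))
      (if-does-yes (p ∣? p) ∣-refl)
    shift : ∀ k → f (p + k) ≡ (if does (p ∣? k) then F (p + k) else 0ℚ)
    shift k = cong (if_then F (p + k) else 0ℚ)
      (does-⇔ (mk⇔ (λ p∣p+k → ∣m+n∣m⇒∣n p∣p+k ∣-refl) (∣m∣n⇒∣m+n ∣-refl)) (p ∣? (p + k)) (p ∣? k))

  -- φ and φ₂ at a new prime factor

  prime∤⇒coprime : ∀ {p m} → Prime p → ¬ p ∣ m → C.Coprime p m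
  prime∤⇒coprime pr p∤m (d∣p , d∣m) with prime⇒irreducible pr d∣p
  ... | inj₁ d≡1 = d≡1
  ... | inj₂ refl = ⊥-elim (p∤m d∣m)

  prime≢⇒∤ : ∀ {q p} → Prime q → Prime p → q ≢ p → ¬ q ∣ p
  prime≢⇒∤ prq prp q≢p q∣p with prime⇒irreducible prp q∣p
  ... | inj₁ q≡1 = ℕ.nonTrivial⇒≢1 {{prime⇒nonTrivial prq}} q≡1
  ... | inj₂ q≡p = q≢p q≡p

  prime∣m*n∧∤m⇒∣n : ∀ {q m n} → Prime q → ¬ q ∣ m → q ∣ m * n → q ∣ n
  prime∣m*n∧∤m⇒∣n {m = m} {n} prq q∤m q∣mn with euclidsLemma m n prq q∣mn
  ... | inj₁ q∣m = ⊥-elim (q∤m q∣m)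
  ... | inj₂ q∣n = q∣n

  χ : ℕ → ℕ → ℚ
  χ m k = if does (gcd k m ℕ.≟ 1) then 1ℚ else 0ℚ

  φ≡∑χ : ∀ n → fromℕ (φ n) ≡ ∑ (χ n) n
  φ≡∑χ n = trans (fromℕ-length-filter (λ k → gcd k n ℕ.≟ 1) (range n)) (foldr-+-range (χ n) n)

  χ-cong : ∀ {a m b n} → (C.Coprime a m → C.Coprime b n) → (C.Coprime b n → C.Coprime a m) → χ m a ≡ χ n b
  χ-cong {a} {m} {b} {n} to from = cong (if_then 1ℚ else 0ℚ) (does-⇔
    (mk⇔ (C.coprime⇒gcd≡1 ∘ to ∘ C.gcd≡1⇒coprime) (C.coprime⇒gcd≡1 ∘ from ∘ C.gcd≡1⇒coprime))
    (gcd a m ℕ.≟ 1) (gcd b n ℕ.≟ 1))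

  χ-periodic : ∀ m k → χ m (m + k) ≡ χ m k
  χ-periodic m k = χ-cong {m + k} {m} {k} {m} (λ c (d∣k , d∣m) → c (∣m∣n⇒∣m+n d∣m d∣k , d∣m))
                                                 (λ c (d∣m+k , d∣m) → c (∣m+n∣m⇒∣n d∣m+k d∣m , d∣m))

  χ-prime* : ∀ {p m} → Prime p → ¬ p ∣ m → ∀ k → χ m (p * k) ≡ χ m k
  χ-prime* {p} {m} pr p∤m k = χ-cong {p * k} {m} {k} {m}
    (λ c (d∣k , d∣m) → c (∣n⇒∣m*n p d∣k , d∣m))
    (λ c {d} (d∣pk , d∣m) →
      c (C.coprime-divisor (λ (e∣d , e∣p) → prime∤⇒coprime pr p∤m (e∣p , ∣-trans e∣d d∣m)) d∣pk , d∣m))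

  χ-split : ∀ {p m} → Prime p → ¬ p ∣ m → ∀ k →
    χ (p * m) k ℚ.+ (if does (p ∣? k) then χ m k else 0ℚ) ≡ χ m k
  χ-split {p} {m} pr p∤m k with p ∣? k
  ... | yes p∣k = trans (cong (ℚ._+ χ m k) (if-does-no (gcd k (p * m) ℕ.≟ 1) (p≢1 ∘ shares-p ∘ C.gcd≡1⇒coprime)))
                        (ℚP.+-identityˡ (χ m k))
    where
    p≢1 : p ≢ 1
    p≢1 = ℕ.nonTrivial⇒≢1 {{prime⇒nonTrivial pr}}
    shares-p : C.Coprime k (p * m) → p ≡ 1
    shares-p c = c (p∣k , m∣m*n m)
  ... | no p∤k = trans (ℚP.+-identityʳ (χ (p * m) k)) (χ-cong {k} {p * m} {k} {m}
    (λ c (d∣k , d∣m) → c (d∣k , ∣n⇒∣m*n p d∣m))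
    (λ c {d} (d∣k , d∣pm) →
      c (d∣k , C.coprime-divisor (λ (e∣d , e∣p) → prime∤⇒coprime pr p∤k (e∣p , ∣-trans e∣d d∣k)) d∣pm)))

  ∑χ[j*m] : ∀ j m → ∑ (χ m) (j * m) ≡ fromℕ j ℚ.* fromℕ (φ m)
  ∑χ[j*m] zero m = sym (ℚP.*-zeroˡ (fromℕ (φ m)))
  ∑χ[j*m] (suc j) m = begin
    ∑ (χ m) (m + j * m)
      ≡⟨ ∑-split (χ m) m (j * m) ⟩
    ∑ (χ m) m ℚ.+ ∑ (λ k → χ m (m + k)) (j * m)
      ≡⟨ cong₂ ℚ._+_ (sym (φ≡∑χ m)) (trans (∑-cong (j * m) (λ k _ _ → χ-periodic m k)) (∑χ[j*m] j m)) ⟩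
    fromℕ (φ m) ℚ.+ fromℕ j ℚ.* fromℕ (φ m)
      ≡⟨ cong (ℚ._+ fromℕ j ℚ.* fromℕ (φ m)) (ℚP.*-identityˡ (fromℕ (φ m))) ⟨
    1ℚ ℚ.* fromℕ (φ m) ℚ.+ fromℕ j ℚ.* fromℕ (φ m)
      ≡⟨ ℚP.*-distribʳ-+ (fromℕ (φ m)) 1ℚ (fromℕ j) ⟨
    (1ℚ ℚ.+ fromℕ j) ℚ.* fromℕ (φ m)
      ≡⟨ cong (ℚ._* fromℕ (φ m)) (fromℕ-+ 1 j) ⟨
    fromℕ (suc j) ℚ.* fromℕ (φ m)
      ∎
    where open ≡-Reasoning

  -- Counting 1 ≤ k ≤ pm coprime to m in two ways: those with p ∤ k are coprime to pm,
  -- and those with p ∣ k are p·a with a ≤ m coprime to m.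
  φ[pm]+φ[m]≡p*φ[m] : ∀ {p m} → Prime p → ¬ p ∣ m →
    fromℕ (φ (p * m)) ℚ.+ fromℕ (φ m) ≡ fromℕ p ℚ.* fromℕ (φ m)
  φ[pm]+φ[m]≡p*φ[m] {p} {m} pr p∤m = begin
    fromℕ (φ (p * m)) ℚ.+ fromℕ (φ m)
      ≡⟨ cong₂ ℚ._+_ (φ≡∑χ (p * m)) (trans (φ≡∑χ m) (sym (∑-cong m (λ k _ _ → χ-prime* pr p∤m k)))) ⟩
    ∑ (χ (p * m)) (p * m) ℚ.+ ∑ (λ a → χ m (p * a)) m
      ≡⟨ cong (∑ (χ (p * m)) (p * m) ℚ.+_) (∑-multiples p (χ m) m) ⟨
    ∑ (χ (p * m)) (p * m) ℚ.+ ∑ [p∣_]χ (p * m)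
      ≡⟨ ∑-+ (χ (p * m)) [p∣_]χ (p * m) ⟨
    ∑ (λ k → χ (p * m) k ℚ.+ [p∣_]χ k) (p * m)
      ≡⟨ ∑-cong (p * m) (λ k _ _ → χ-split pr p∤m k) ⟩
    ∑ (χ m) (p * m)
      ≡⟨ ∑χ[j*m] p m ⟩
    fromℕ p ℚ.* fromℕ (φ m)
      ∎
    where
    open ≡-Reasoning
    instance _ = prime⇒nonZero pr
    [p∣_]χ : ℕ → ℚ
    [p∣ k ]χ = if does (p ∣? k) then χ m k else 0ℚ

  φ-*-prime : ∀ {p m} → Prime p → ¬ p ∣ m → φ (p * m) ≡ (p ∸ 1) * φ m
  φ-*-prime {p} {m} pr p∤m = ℕP.+-cancelʳ-≡ (φ m) (φ (p * m)) ((p ∸ 1) * φ m) (begin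
    φ (p * m) + φ m         ≡⟨ fromℕ-injective (trans (fromℕ-+ (φ (p * m)) (φ m))
                                 (trans (φ[pm]+φ[m]≡p*φ[m] pr p∤m) (sym (fromℕ-* p (φ m))))) ⟩
    p * φ m                 ≡⟨ cong (_* φ m) (ℕP.suc-pred p) ⟨
    suc (p ∸ 1) * φ m       ≡⟨ ℕP.+-comm (φ m) ((p ∸ 1) * φ m) ⟩
    (p ∸ 1) * φ m + φ m     ∎)
    where
    open ≡-Reasoning
    instance _ = prime⇒nonZero pr

  0<φ : ∀ n .{{_ : NonZero n}} → 0 < φ n
  0<φ (suc n) rewrite dec-true (gcd 1 (suc n) ℕ.≟ 1) (C.coprime⇒gcd≡1 (C.1-coprimeTo (suc n))) = s≤s z≤n

  pred₂ : ℕ → ℚ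
  pred₂ k = fromℕ k ℚ.- fromℕ 2

  ψ : ℕ → ℕ → ℚ
  ψ n k = if does (prime? k) then (if does (k ∣? n) then pred₂ k else 1ℚ) else 1ℚ

  φ₂≡∏ψ : ∀ n → φ₂ n ≡ ∏ (ψ n) n
  φ₂≡∏ψ n = begin
    φ₂ n                                                            ≡⟨ foldr-map ℚ._*_ pred₂ 1ℚ (primeDivisors n) ⟨
    foldr ℚ._*_ 1ℚ (map pred₂ (filter (_∣? n) (primesUpTo n)))      ≡⟨ productq-filter (_∣? n) pred₂ (primesUpTo n) ⟩
    foldr ℚ._*_ 1ℚ (map (λ k → if does (k ∣? n) then pred₂ k else 1ℚ) (filter prime? (range n)))
                                                                    ≡⟨ productq-filter prime? _ (range n) ⟩
    foldr ℚ._*_ 1ℚ (map (ψ n) (range n))                            ≡⟨ foldr-*-range (ψ n) n ⟩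
    ∏ (ψ n) n                                                       ∎
    where open ≡-Reasoning

  ψ-∤ : ∀ {n k} → ¬ k ∣ n → ψ n k ≡ 1ℚ
  ψ-∤ {n} {k} k∤n with prime? k
  ... | yes _ = if-does-no (k ∣? n) k∤n
  ... | no _ = refl

  ψ-cong : ∀ {m n k} → (Prime k → k ∣ m → k ∣ n) → (Prime k → k ∣ n → k ∣ m) → ψ m k ≡ ψ n k
  ψ-cong {m} {n} {k} to from with prime? k
  ... | yes pr = cong (if_then pred₂ k else 1ℚ) (does-⇔ (mk⇔ (to pr) (from pr)) (k ∣? m) (k ∣? n))
  ... | no _ = refl

  δ : ℕ → ℕ → ℚ
  δ p k = if does (k ℕ.≟ p) then pred₂ p else 1ℚ

  ψ-*-prime : ∀ {p m} → Prime p → ¬ p ∣ m → ∀ k → ψ (p * m) k ≡ ψ m k ℚ.* δ p k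
  ψ-*-prime {p} {m} pr p∤m k with k ℕ.≟ p
  ... | yes refl = begin
    ψ (k * m) k
      ≡⟨ trans (if-does-yes (prime? k) pr) (if-does-yes (k ∣? k * m) (m∣m*n m)) ⟩
    pred₂ k
      ≡⟨ ℚP.*-identityˡ (pred₂ k) ⟨
    1ℚ ℚ.* pred₂ k
      ≡⟨ cong₂ ℚ._*_ (trans (if-does-yes (prime? k) pr) (if-does-no (k ∣? m) p∤m)) (if-does-yes (k ℕ.≟ k) refl) ⟨
    ψ m k ℚ.* δ k k
      ∎
    where open ≡-Reasoning
  ... | no k≢p = begin
    ψ (p * m) k            ≡⟨ ψ-cong (λ prk → prime∣m*n∧∤m⇒∣n prk (prime≢⇒∤ prk pr k≢p)) (λ _ → ∣n⇒∣m*n p) ⟩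
    ψ m k                  ≡⟨ ℚP.*-identityʳ (ψ m k) ⟨
    ψ m k ℚ.* 1ℚ           ≡⟨ cong (ψ m k ℚ.*_) (if-does-no (k ℕ.≟ p) k≢p) ⟨
    ψ m k ℚ.* δ p k        ∎
    where open ≡-Reasoning

  φ₂-*-prime : ∀ {p m} .{{_ : NonZero m}} → Prime p → ¬ p ∣ m → φ₂ (p * m) ≡ pred₂ p ℚ.* φ₂ m
  φ₂-*-prime {p} {m} pr p∤m = begin
    φ₂ (p * m)                              ≡⟨ φ₂≡∏ψ (p * m) ⟩
    ∏ (ψ (p * m)) (p * m)                   ≡⟨ ∏-cong (p * m) (λ k _ _ → ψ-*-prime pr p∤m k) ⟩
    ∏ (λ k → ψ m k ℚ.* δ p k) (p * m)       ≡⟨ ∏-* (ψ m) (δ p) (p * m) ⟩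
    ∏ (ψ m) (p * m) ℚ.* ∏ (δ p) (p * m)     ≡⟨ cong₂ ℚ._*_ ∏ψ-truncate ∏δ-single ⟩
    ∏ (ψ m) m ℚ.* pred₂ p                   ≡⟨ cong (ℚ._* pred₂ p) (φ₂≡∏ψ m) ⟨
    φ₂ m ℚ.* pred₂ p                        ≡⟨ ℚP.*-comm (φ₂ m) (pred₂ p) ⟩
    pred₂ p ℚ.* φ₂ m                        ∎
    where
    open ≡-Reasoning
    instance _ = prime⇒nonZero pr
    ∏ψ-truncate : ∏ (ψ m) (p * m) ≡ ∏ (ψ m) m
    ∏ψ-truncate = ∏-truncate (ψ m) (ℕP.m≤n*m m p) (λ k m<k _ → ψ-∤ (>⇒∤ m<k))
    ∏δ-single : ∏ (δ p) (p * m) ≡ pred₂ p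
    ∏δ-single = trans (∏-single (δ p) (p * m) p (ℕ.>-nonZero⁻¹ p) (ℕP.m≤m*n p m) (λ k _ _ k≢p → if-does-no (k ℕ.≟ p) k≢p))
                      (if-does-yes (p ℕ.≟ p) refl)

  prime⇒2≤p : ∀ {p} → Prime p → 2 ≤ p
  prime⇒2≤p {p} pr = ℕ.nonTrivial⇒n>1 p {{prime⇒nonTrivial pr}}

  pred₂≡fromℕ∸2 : ∀ {p} → 2 ≤ p → pred₂ p ≡ fromℕ (p ∸ 2)
  pred₂≡fromℕ∸2 {suc (suc k)} (s≤s (s≤s z≤n)) = trans (cong (ℚ._- fromℕ 2) (fromℕ-+ 2 k))
    (solve 2 (λ t k → (t :+ k) :- t := k) refl (fromℕ 2) (fromℕ k))
    where open +-*-Solver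

  0<fromℕ-φ : ∀ n .{{_ : NonZero n}} → 0ℚ ℚ.< fromℕ (φ n)
  0<fromℕ-φ n = 0<fromℕ (φ n) {{ℕ.>-nonZero (0<φ n)}}

  fromℕ-φ≢0 : ∀ n .{{_ : NonZero n}} → fromℕ (φ n) ≢ 0ℚ
  fromℕ-φ≢0 n = ℚP.<⇒≢ (0<fromℕ-φ n) ∘ sym

  θ : ℕ → ℚ
  θ n = divq ∣ φ₂ n ∣ (fromℕ (φ n))

  θ-nonneg : ∀ n → 0ℚ ℚ.≤ θ n
  θ-nonneg n = divq-nonneg (ℚP.0≤∣p∣ (φ₂ n)) (0≤fromℕ (φ n))

  θ-*-prime : ∀ {p m} .{{_ : NonZero m}} → Prime p → ¬ p ∣ m →
    fromℕ (p ∸ 1) ℚ.* θ (p * m) ≡ fromℕ (p ∸ 2) ℚ.* θ m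
  θ-*-prime {p} {m} pr p∤m = *-cancelʳ-≡ Φ (fromℕ-φ≢0 m) (begin
    fromℕ (p ∸ 1) ℚ.* θ (p * m) ℚ.* Φ
      ≡⟨ solve 3 (λ s t f → s :* t :* f := t :* (s :* f)) refl (fromℕ (p ∸ 1)) (θ (p * m)) Φ ⟩
    θ (p * m) ℚ.* (fromℕ (p ∸ 1) ℚ.* Φ)
      ≡⟨ cong (θ (p * m) ℚ.*_) (trans (cong fromℕ (φ-*-prime pr p∤m)) (fromℕ-* (p ∸ 1) (φ m))) ⟨
    θ (p * m) ℚ.* fromℕ (φ (p * m))
      ≡⟨ divq-*-cancel ∣ φ₂ (p * m) ∣ _ (fromℕ-φ≢0 (p * m) {{ℕP.m*n≢0 p m}}) ⟩
    ∣ φ₂ (p * m) ∣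
      ≡⟨ cong ∣_∣ (φ₂-*-prime pr p∤m) ⟩
    ∣ pred₂ p ℚ.* φ₂ m ∣
      ≡⟨ ℚP.∣p*q∣≡∣p∣*∣q∣ (pred₂ p) (φ₂ m) ⟩
    ∣ pred₂ p ∣ ℚ.* ∣ φ₂ m ∣
      ≡⟨ cong (λ x → ∣ x ∣ ℚ.* ∣ φ₂ m ∣) (pred₂≡fromℕ∸2 (prime⇒2≤p pr)) ⟩
    ∣ fromℕ (p ∸ 2) ∣ ℚ.* ∣ φ₂ m ∣
      ≡⟨ cong (ℚ._* ∣ φ₂ m ∣) (ℚP.0≤p⇒∣p∣≡p (0≤fromℕ (p ∸ 2))) ⟩
    fromℕ (p ∸ 2) ℚ.* ∣ φ₂ m ∣
      ≡⟨ cong (fromℕ (p ∸ 2) ℚ.*_) (divq-*-cancel ∣ φ₂ m ∣ Φ (fromℕ-φ≢0 m)) ⟨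
    fromℕ (p ∸ 2) ℚ.* (θ m ℚ.* Φ)
      ≡⟨ ℚP.*-assoc (fromℕ (p ∸ 2)) (θ m) Φ ⟨
    fromℕ (p ∸ 2) ℚ.* θ m ℚ.* Φ
      ∎)
    where
    open ≡-Reasoning
    open +-*-Solver
    instance _ = prime⇒nonZero pr
    Φ : ℚ
    Φ = fromℕ (φ m)

  -- The majorant Ξ of ξ and its recurrence

  ∑cube : (ℕ → ℕ → ℕ → ℚ) → ℕ → ℚ
  ∑cube H n = ∑ (λ a → ∑ (λ b → ∑ (H a b) n) n) n

  ∑cube-cong : ∀ {H H′} n → (∀ a b c → 1 ≤ a → a ≤ n → 1 ≤ b → b ≤ n → 1 ≤ c → c ≤ n → H a b c ≡ H′ a b c) →
    ∑cube H n ≡ ∑cube H′ n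
  ∑cube-cong n H≡H′ = ∑-cong n (λ a 1≤a a≤n → ∑-cong n (λ b 1≤b b≤n → ∑-cong n (λ c 1≤c c≤n →
    H≡H′ a b c 1≤a a≤n 1≤b b≤n 1≤c c≤n)))

  ∑cube-+ : ∀ H H′ n → ∑cube (λ a b c → H a b c ℚ.+ H′ a b c) n ≡ ∑cube H n ℚ.+ ∑cube H′ n
  ∑cube-+ H H′ n = trans
    (∑-cong n (λ a _ _ → trans (∑-cong n (λ b _ _ → ∑-+ (H a b) (H′ a b) n))
                               (∑-+ (λ b → ∑ (H a b) n) (λ b → ∑ (H′ a b) n) n)))
    (∑-+ (λ a → ∑ (λ b → ∑ (H a b) n) n) (λ a → ∑ (λ b → ∑ (H′ a b) n) n) n)

  ∑cube-scale : ∀ r H n → ∑cube (λ a b c → r ℚ.* H a b c) n ≡ r ℚ.* ∑cube H n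
  ∑cube-scale r H n = trans
    (∑-cong n (λ a _ _ → trans (∑-cong n (λ b _ _ → ∑-scale r (H a b) n)) (∑-scale r (λ b → ∑ (H a b) n) n)))
    (∑-scale r (λ a → ∑ (λ b → ∑ (H a b) n) n) n)

  ∑cube-swap₁₂ : ∀ H n → ∑cube H n ≡ ∑cube (λ a b c → H b a c) n
  ∑cube-swap₁₂ H n = ∑-swap (λ a b → ∑ (H a b) n) n n

  ∑cube-swap₂₃ : ∀ H n → ∑cube H n ≡ ∑cube (λ a b c → H a c b) n
  ∑cube-swap₂₃ H n = ∑-cong n (λ a _ _ → ∑-swap (H a) n n)

  ∑cube-swap₁₃ : ∀ H n → ∑cube H n ≡ ∑cube (λ a b c → H c b a) n
  ∑cube-swap₁₃ H n = trans (∑cube-swap₁₂ H n)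
    (trans (∑cube-swap₂₃ (λ a b c → H b a c) n) (∑cube-swap₁₂ (λ a b c → H c a b) n))

  ∑²-if : ∀ (β : Bool) (X : ℕ → ℕ → ℚ) n →
    ∑ (λ b → ∑ (λ c → if β then X b c else 0ℚ) n) n ≡ (if β then ∑ (λ b → ∑ (X b) n) n else 0ℚ)
  ∑²-if true X n = refl
  ∑²-if false X n = ∑-0 _ n (λ b _ _ → ∑-0 _ n (λ c _ _ → refl))

  ∑₃ : (ℕ → ℕ → ℕ → ℚ) → ℕ → ℚ
  ∑₃ F n = ∑cube (λ a b c → if a * b * c ℕ.≡ᵇ n then F a b c else 0ℚ) n

  Ξ : ℕ → ℚ
  Ξ = ∑₃ (λ _ _ c → θ c)

  c*b*a≡a*b*c : ∀ a b c → c * b * a ≡ a * b * c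
  c*b*a≡a*b*c a b c = trans (ℕP.*-comm (c * b) a) (trans (cong (a *_) (ℕP.*-comm c b)) (sym (ℕP.*-assoc a b c)))

  ∑₃-swap₁₃ : ∀ F n → ∑₃ F n ≡ ∑₃ (λ a b c → F c b a) n
  ∑₃-swap₁₃ F n = trans (∑cube-swap₁₃ _ n)
    (∑cube-cong n (λ a b c _ _ _ _ _ _ → cong (λ t → if t ℕ.≡ᵇ n then F c b a else 0ℚ) (c*b*a≡a*b*c a b c)))

  ∑²-shrink : ∀ (F : ℕ → ℕ → ℚ) a {m N} → 1 ≤ a → m ≤ N →
    ∑ (λ b → ∑ (λ c → if a * b * c ℕ.≡ᵇ m then F b c else 0ℚ) N) N ≡
    ∑ (λ b → ∑ (λ c → if a * b * c ℕ.≡ᵇ m then F b c else 0ℚ) m) m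
  ∑²-shrink F a {m} {N} 1≤a m≤N = trans
    (∑-truncate _ m≤N (λ b m<b _ → ∑-0 _ N (λ c 1≤c _ →
      if-does-no (a * b * c ℕ.≟ m) (λ e → ℕP.<⇒≱ m<b (subst (b ≤_) e (b≤abc 1≤c))))))
    (∑-cong m (λ b 1≤b _ → ∑-truncate _ m≤N (λ c m<c _ →
      if-does-no (a * b * c ℕ.≟ m) (λ e → ℕP.<⇒≱ m<c (subst (c ≤_) e (c≤abc 1≤b))))))
    where
    b≤abc : ∀ {b c} → 1 ≤ c → b ≤ a * b * c
    b≤abc {b} {c} 1≤c = ℕP.≤-trans (ℕP.m≤n*m b a {{ℕ.>-nonZero 1≤a}}) (ℕP.m≤m*n (a * b) c {{ℕ.>-nonZero 1≤c}})
    c≤abc : ∀ {b c} → 1 ≤ b → c ≤ a * b * c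
    c≤abc {b} {c} 1≤b = ℕP.m≤n*m c (a * b) {{ℕ.>-nonZero (ℕP.*-mono-≤ 1≤a 1≤b)}}

  ∑cube-multiples : ∀ p .{{_ : NonZero p}} m (F : ℕ → ℕ → ℕ → ℚ) →
    ∑cube (λ a b c → if does (p ∣? a) then (if a * b * c ℕ.≡ᵇ p * m then F a b c else 0ℚ) else 0ℚ) (p * m)
    ≡ ∑₃ (λ a b c → F (p * a) b c) m
  ∑cube-multiples p m F = begin
    ∑cube (λ a b c → if does (p ∣? a) then I a b c else 0ℚ) N
      ≡⟨ ∑-cong N (λ a _ _ → ∑²-if (does (p ∣? a)) (I a) N) ⟩
    ∑ (λ a → if does (p ∣? a) then ∑ (λ b → ∑ (I a b) N) N else 0ℚ) N
      ≡⟨ ∑-multiples p (λ a → ∑ (λ b → ∑ (I a b) N) N) m ⟩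
    ∑ (λ a → ∑ (λ b → ∑ (I (p * a) b) N) N) m
      ≡⟨ ∑-cong m (λ a 1≤a _ → trans (∑-cong N (λ b _ _ → ∑-cong N (λ c _ _ → cancel-p a b c)))
                                     (∑²-shrink (F (p * a)) a 1≤a (ℕP.m≤n*m m p))) ⟩
    ∑₃ (λ a b c → F (p * a) b c) m
      ∎
    where
    open ≡-Reasoning
    N : ℕ
    N = p * m
    I : ℕ → ℕ → ℕ → ℚ
    I a b c = if a * b * c ℕ.≡ᵇ N then F a b c else 0ℚ
    p*a*b*c≡p*[a*b*c] : ∀ a b c → p * a * b * c ≡ p * (a * b * c)
    p*a*b*c≡p*[a*b*c] a b c = trans (cong (_* c) (ℕP.*-assoc p a b)) (ℕP.*-assoc p (a * b) c)
    cancel-p : ∀ a b c → I (p * a) b c ≡ (if a * b * c ℕ.≡ᵇ m then F (p * a) b c else 0ℚ)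
    cancel-p a b c = cong (if_then F (p * a) b c else 0ℚ) (does-⇔
      (mk⇔ (λ e → ℕP.*-cancelˡ-≡ (a * b * c) m p (trans (sym (p*a*b*c≡p*[a*b*c] a b c)) e))
           (λ e → trans (p*a*b*c≡p*[a*b*c] a b c) (cong (p *_) e)))
      (p * a * b * c ℕ.≟ N) (a * b * c ℕ.≟ m))

  if-const : ∀ (β : Bool) {x : ℚ} → (if β then x else x) ≡ x
  if-const true = refl
  if-const false = refl

  -- If abc = pm with p ∤ m, then p divides exactly one of a, b, c.
  [abc≡pm]-split : ∀ {p m} → Prime p → ¬ p ∣ m → ∀ a b c (X : ℚ) →
    let [abc≡pm]X = if a * b * c ℕ.≡ᵇ p * m then X else 0ℚ in
    [abc≡pm]X ≡ (if does (p ∣? a) then [abc≡pm]X else 0ℚ) ℚ.+ (if does (p ∣? b) then [abc≡pm]X else 0ℚ)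
                 ℚ.+ (if does (p ∣? c) then [abc≡pm]X else 0ℚ)
  [abc≡pm]-split {p} {m} pr p∤m a b c X = by-cases (a * b * c ℕ.≟ p * m) (p ∣? a) (p ∣? b) (p ∣? c)
    where
    instance _ = prime⇒nonZero pr
    p²∤ : p * p ∣ a * b * c → a * b * c ≡ p * m → ⊥
    p²∤ p²∣abc e = p∤m (*-cancelˡ-∣ p (subst (p * p ∣_) e p²∣abc))
    p²∣a*[b*c]⇒p²∣abc : p * p ∣ a * (b * c) → p * p ∣ a * b * c
    p²∣a*[b*c]⇒p²∣abc = subst (p * p ∣_) (sym (ℕP.*-assoc a b c))
    p∣abc : a * b * c ≡ p * m → (p ∣ a) ⊎ (p ∣ b) ⊎ (p ∣ c)
    p∣abc e with euclidsLemma (a * b) c pr (subst (p ∣_) (sym e) (m∣m*n m))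
    ... | inj₂ p∣c = inj₂ (inj₂ p∣c)
    ... | inj₁ p∣ab with euclidsLemma a b pr p∣ab
    ...   | inj₁ p∣a = inj₁ p∣a
    ...   | inj₂ p∣b = inj₂ (inj₁ p∣b)
    by-cases : (E : Dec (a * b * c ≡ p * m)) (da : Dec (p ∣ a)) (db : Dec (p ∣ b)) (dc : Dec (p ∣ c)) →
      let [E]X = if does E then X else 0ℚ in
      [E]X ≡ (if does da then [E]X else 0ℚ) ℚ.+ (if does db then [E]X else 0ℚ) ℚ.+ (if does dc then [E]X else 0ℚ)
    by-cases (no _) da db dc =
      sym (cong₂ ℚ._+_ (cong₂ ℚ._+_ (if-const (does da)) (if-const (does db))) (if-const (does dc)))
    by-cases (yes e) (yes x) (yes y) _ = ⊥-elim (p²∤ (∣m⇒∣m*n c (*-pres-∣ x y)) e)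
    by-cases (yes e) (yes x) (no _) (yes z) = ⊥-elim (p²∤ (p²∣a*[b*c]⇒p²∣abc (*-pres-∣ x (∣n⇒∣m*n b z))) e)
    by-cases (yes e) (no _) (yes y) (yes z) = ⊥-elim (p²∤ (p²∣a*[b*c]⇒p²∣abc (∣n⇒∣m*n a (*-pres-∣ y z))) e)
    by-cases (yes e) (no p∤a) (no p∤b) (no p∤c) with p∣abc e
    ... | inj₁ p∣a = ⊥-elim (p∤a p∣a)
    ... | inj₂ (inj₁ p∣b) = ⊥-elim (p∤b p∣b)
    ... | inj₂ (inj₂ p∣c) = ⊥-elim (p∤c p∣c)
    by-cases (yes e) (yes _) (no _) (no _) = sym (trans (ℚP.+-identityʳ _) (ℚP.+-identityʳ X))
    by-cases (yes e) (no _) (yes _) (no _) = sym (trans (ℚP.+-identityʳ _) (ℚP.+-identityˡ X))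
    by-cases (yes e) (no _) (no _) (yes _) = sym (ℚP.+-identityˡ X)

  ∑₃-split-prime : ∀ {p m} → Prime p → ¬ p ∣ m → ∀ F →
    ∑₃ F (p * m) ≡ ∑₃ (λ a b c → F (p * a) b c) m ℚ.+ ∑₃ (λ a b c → F b (p * a) c) m
                   ℚ.+ ∑₃ (λ a b c → F c b (p * a)) m
  ∑₃-split-prime {p} {m} pr p∤m F = begin
    ∑₃ F N
      ≡⟨ ∑cube-cong N (λ a b c _ _ _ _ _ _ → [abc≡pm]-split pr p∤m a b c (F a b c)) ⟩
    ∑cube (λ a b c → Dᵃ a b c ℚ.+ Dᵇ a b c ℚ.+ Dᶜ a b c) N
      ≡⟨ ∑cube-+ (λ a b c → Dᵃ a b c ℚ.+ Dᵇ a b c) Dᶜ N ⟩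
    ∑cube (λ a b c → Dᵃ a b c ℚ.+ Dᵇ a b c) N ℚ.+ ∑cube Dᶜ N
      ≡⟨ cong (ℚ._+ ∑cube Dᶜ N) (∑cube-+ Dᵃ Dᵇ N) ⟩
    ∑cube Dᵃ N ℚ.+ ∑cube Dᵇ N ℚ.+ ∑cube Dᶜ N
      ≡⟨ cong₂ ℚ._+_ (cong₂ ℚ._+_ (∑cube-multiples p m F) ∑Dᵇ) ∑Dᶜ ⟩
    ∑₃ (λ a b c → F (p * a) b c) m ℚ.+ ∑₃ (λ a b c → F b (p * a) c) m ℚ.+ ∑₃ (λ a b c → F c b (p * a)) m
      ∎
    where
    open ≡-Reasoning
    instance _ = prime⇒nonZero pr
    N : ℕ
    N = p * m
    I : ℕ → ℕ → ℕ → ℚ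
    I a b c = if a * b * c ℕ.≡ᵇ N then F a b c else 0ℚ
    Dᵃ Dᵇ Dᶜ : ℕ → ℕ → ℕ → ℚ
    Dᵃ a b c = if does (p ∣? a) then I a b c else 0ℚ
    Dᵇ a b c = if does (p ∣? b) then I a b c else 0ℚ
    Dᶜ a b c = if does (p ∣? c) then I a b c else 0ℚ
    ∑Dᵇ : ∑cube Dᵇ N ≡ ∑₃ (λ a b c → F b (p * a) c) m
    ∑Dᵇ = trans (∑cube-swap₁₂ Dᵇ N)
      (trans (∑cube-cong N (λ a b c _ _ _ _ _ _ → cong (if does (p ∣? a) then_else 0ℚ)
                              (cong (λ t → if t ℕ.≡ᵇ N then F b a c else 0ℚ) (cong (_* c) (ℕP.*-comm b a)))))
             (∑cube-multiples p m (λ a b c → F b a c)))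
    ∑Dᶜ : ∑cube Dᶜ N ≡ ∑₃ (λ a b c → F c b (p * a)) m
    ∑Dᶜ = trans (∑cube-swap₁₃ Dᶜ N)
      (trans (∑cube-cong N (λ a b c _ _ _ _ _ _ → cong (if does (p ∣? a) then_else 0ℚ)
                              (cong (λ t → if t ℕ.≡ᵇ N then F c b a else 0ℚ) (c*b*a≡a*b*c a b c))))
             (∑cube-multiples p m (λ a b c → F c b a)))

  ∑₃-scale : ∀ {r s F G} m → (∀ a b c → a * b * c ≡ m → r ℚ.* F a b c ≡ s ℚ.* G a b c) →
    r ℚ.* ∑₃ F m ≡ s ℚ.* ∑₃ G m
  ∑₃-scale {r} {s} {F} {G} m rF≡sG = begin
    r ℚ.* ∑₃ F m
      ≡⟨ ∑cube-scale r _ m ⟨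
    ∑cube (λ a b c → r ℚ.* (if a * b * c ℕ.≡ᵇ m then F a b c else 0ℚ)) m
      ≡⟨ ∑cube-cong m (λ a b c _ _ _ _ _ _ → pointwise a b c (a * b * c ℕ.≟ m)) ⟩
    ∑cube (λ a b c → s ℚ.* (if a * b * c ℕ.≡ᵇ m then G a b c else 0ℚ)) m
      ≡⟨ ∑cube-scale s _ m ⟩
    s ℚ.* ∑₃ G m
      ∎
    where
    open ≡-Reasoning
    pointwise : ∀ a b c (E : Dec (a * b * c ≡ m)) →
      r ℚ.* (if does E then F a b c else 0ℚ) ≡ s ℚ.* (if does E then G a b c else 0ℚ)
    pointwise a b c (yes e) = rF≡sG a b c e
    pointwise a b c (no _) = trans (ℚP.*-zeroʳ r) (sym (ℚP.*-zeroʳ s))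

  nonZero-factor : ∀ {a b c m} .{{_ : NonZero m}} → a * b * c ≡ m → NonZero c
  nonZero-factor {a} refl = ℕP.m*n≢0⇒n≢0 (a * _)

  3*p∸4≡ : ∀ {p} → 2 ≤ p → 3 * p ∸ 4 ≡ (p ∸ 1) + (p ∸ 1) + (p ∸ 2)
  3*p∸4≡ {suc (suc k)} (s≤s (s≤s z≤n)) = cong (_∸ 4)
    (solve 1 (λ k → con 3 :* (con 2 :+ k) := con 4 :+ ((con 1 :+ k) :+ (con 1 :+ k) :+ k)) refl k)
    where open ℕ-Solver.+-*-Solver

  -- Of the three positions for the new prime p in a factorisation of pm, two leave θ(c) unchanged
  -- and the third multiplies it by (p - 2)/(p - 1).
  Ξ-recurrence : ∀ {p m} .{{_ : NonZero m}} → Prime p → ¬ p ∣ m →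
    fromℕ (p ∸ 1) ℚ.* Ξ (p * m) ≡ fromℕ (3 * p ∸ 4) ℚ.* Ξ m
  Ξ-recurrence {p} {m} pr p∤m = begin
    s ℚ.* Ξ (p * m)
      ≡⟨ cong (s ℚ.*_) (∑₃-split-prime pr p∤m (λ _ _ c → θ c)) ⟩
    s ℚ.* (Ξ m ℚ.+ Ξ m ℚ.+ ∑₃ (λ a _ _ → θ (p * a)) m)
      ≡⟨ cong (λ t → s ℚ.* (Ξ m ℚ.+ Ξ m ℚ.+ t)) (∑₃-swap₁₃ _ m) ⟩
    s ℚ.* (Ξ m ℚ.+ Ξ m ℚ.+ ∑₃ (λ _ _ c → θ (p * c)) m)
      ≡⟨ ℚP.*-distribˡ-+ s (Ξ m ℚ.+ Ξ m) _ ⟩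
    s ℚ.* (Ξ m ℚ.+ Ξ m) ℚ.+ s ℚ.* ∑₃ (λ _ _ c → θ (p * c)) m
      ≡⟨ cong (s ℚ.* (Ξ m ℚ.+ Ξ m) ℚ.+_) (∑₃-scale {s} {fromℕ (p ∸ 2)} {λ _ _ c → θ (p * c)} {λ _ _ c → θ c} m θ-step) ⟩
    s ℚ.* (Ξ m ℚ.+ Ξ m) ℚ.+ fromℕ (p ∸ 2) ℚ.* Ξ m
      ≡⟨ solve 3 (λ s t x → s :* (x :+ x) :+ t :* x := (s :+ s :+ t) :* x) refl s (fromℕ (p ∸ 2)) (Ξ m) ⟩
    (s ℚ.+ s ℚ.+ fromℕ (p ∸ 2)) ℚ.* Ξ m
      ≡⟨ cong (ℚ._* Ξ m) fromℕ[3p∸4] ⟨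
    fromℕ (3 * p ∸ 4) ℚ.* Ξ m
      ∎
    where
    open ≡-Reasoning
    open +-*-Solver
    s : ℚ
    s = fromℕ (p ∸ 1)
    θ-step : ∀ a b c → a * b * c ≡ m → s ℚ.* θ (p * c) ≡ fromℕ (p ∸ 2) ℚ.* θ c
    θ-step a b c e = θ-*-prime {{nonZero-factor {a} {b} e}} pr (λ p∣c → p∤m (∣-trans p∣c (divides (a * b) (sym e))))
    fromℕ[3p∸4] : fromℕ (3 * p ∸ 4) ≡ s ℚ.+ s ℚ.+ fromℕ (p ∸ 2)
    fromℕ[3p∸4] = trans (cong fromℕ (3*p∸4≡ (prime⇒2≤p pr)))
      (trans (fromℕ-+ ((p ∸ 1) + (p ∸ 1)) (p ∸ 2)) (cong (ℚ._+ fromℕ (p ∸ 2)) (fromℕ-+ (p ∸ 1) (p ∸ 1))))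

  -- Comparing G_[q] with G_τ

  ∣powq[-1]∣≡1 : ∀ k → ∣ powq (ℚ.- 1ℚ) k ∣ ≡ 1ℚ
  ∣powq[-1]∣≡1 zero = refl
  ∣powq[-1]∣≡1 (suc k) = trans (ℚP.∣p*q∣≡∣p∣*∣q∣ (ℚ.- 1ℚ) (powq (ℚ.- 1ℚ) k)) (cong (1ℚ ℚ.*_) (∣powq[-1]∣≡1 k))

  ∣μ∣≤1 : ∀ n → ∣ μ n ∣ ℚ.≤ 1ℚ
  ∣μ∣≤1 n with squarefreeᵇ n
  ... | true = ℚP.≤-reflexive (∣powq[-1]∣≡1 (length (primeDivisors n)))
  ... | false = ℚP.≤ᵇ⇒≤ tt

  h-nonneg : ∀ ℓ → 0ℚ ℚ.≤ h ℓ
  h-nonneg ℓ = divq-nonneg (square-nonneg (μ ℓ)) (0≤fromℕ (φ ℓ))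

  if-nonneg : ∀ (β : Bool) {x} → 0ℚ ℚ.≤ x → 0ℚ ℚ.≤ (if β then x else 0ℚ)
  if-nonneg true 0≤x = 0≤x
  if-nonneg false _ = ℚP.≤-refl

  ∣if∣≤if : ∀ (β γ : Bool) → (T β → T γ) → ∀ {x y} → ∣ x ∣ ℚ.≤ y → 0ℚ ℚ.≤ y →
    ∣ (if β then x else 0ℚ) ∣ ℚ.≤ (if γ then y else 0ℚ)
  ∣if∣≤if true true _ ∣x∣≤y _ = ∣x∣≤y
  ∣if∣≤if true false β⇒γ _ _ = ⊥-elim (β⇒γ _)
  ∣if∣≤if false γ _ _ 0≤y = if-nonneg γ 0≤y

  ∑cube-nonneg : ∀ {H} n → (∀ a b c → 0ℚ ℚ.≤ H a b c) → 0ℚ ℚ.≤ ∑cube H n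
  ∑cube-nonneg n 0≤H = ∑-nonneg n (λ a _ _ → ∑-nonneg n (λ b _ _ → ∑-nonneg n (λ c _ _ → 0≤H a b c)))

  ∣∑cube∣≤∑cube : ∀ {H H′} n → (∀ a b c → ∣ H a b c ∣ ℚ.≤ H′ a b c) → ∣ ∑cube H n ∣ ℚ.≤ ∑cube H′ n
  ∣∑cube∣≤∑cube n ∣H∣≤H′ = ∣∑∣≤∑ n (λ a _ _ → ∣∑∣≤∑ n (λ b _ _ → ∣∑∣≤∑ n (λ c _ _ → ∣H∣≤H′ a b c)))

  Ξ-nonneg : ∀ q → 0ℚ ℚ.≤ Ξ q
  Ξ-nonneg q = ∑cube-nonneg q (λ a b c → if-nonneg (a * b * c ℕ.≡ᵇ q) (θ-nonneg c))

  ξ-summand : ℕ → ℚ → ℕ → ℕ → ℕ → ℚ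
  ξ-summand q y q₁ q₂ q₃ =
    if (q₁ * q₂ * q₃ ℕ.≡ᵇ q) ∧ (fromℕ (q₁ * q₃) ℚ.≤ᵇ y) ∧ (fromℕ (q₂ * q₃) ℚ.≤ᵇ y)
    then divq (μ q₃ ℚ.* φ₂ q₃) (fromℕ (φ q₃)) else 0ℚ

  ξ≡∑cube : ∀ q y → ξ q y ≡ ∑cube (ξ-summand q y) q
  ξ≡∑cube q y = begin
    sumq (concatMap (λ q₁ → concatMap (λ q₂ → map (ξ-summand q y q₁ q₂) (range q)) (range q)) (range q))
      ≡⟨ sumq-concatMap _ (range q) ⟩
    sumq (map (λ q₁ → sumq (concatMap (λ q₂ → map (ξ-summand q y q₁ q₂) (range q)) (range q))) (range q))
      ≡⟨ foldr-+-range _ q ⟩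
    ∑ (λ q₁ → sumq (concatMap (λ q₂ → map (ξ-summand q y q₁ q₂) (range q)) (range q))) q
      ≡⟨ ∑-cong q (λ q₁ _ _ → trans (sumq-concatMap _ (range q)) (foldr-+-range _ q)) ⟩
    ∑ (λ q₁ → ∑ (λ q₂ → sumq (map (ξ-summand q y q₁ q₂) (range q))) q) q
      ≡⟨ ∑-cong q (λ q₁ _ _ → ∑-cong q (λ q₂ _ _ → foldr-+-range _ q)) ⟩
    ∑cube (ξ-summand q y) q
      ∎
    where open ≡-Reasoning

  ∣ξ∣≤Ξ : ∀ q y → ∣ ξ q y ∣ ℚ.≤ Ξ q
  ∣ξ∣≤Ξ q y = subst (λ x → ∣ x ∣ ℚ.≤ Ξ q) (sym (ξ≡∑cube q y)) (∣∑cube∣≤∑cube q (λ a b c →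
    ∣if∣≤if _ (a * b * c ℕ.≡ᵇ q) (proj₁ ∘ Equivalence.to T-∧) (∣summand∣≤θ {c}) (θ-nonneg c)))
    where
    ∣summand∣≤θ : ∀ {n} → ∣ divq (μ n ℚ.* φ₂ n) (fromℕ (φ n)) ∣ ℚ.≤ θ n
    ∣summand∣≤θ {n} = ∣divq∣≤divq (fromℕ (φ n)) (0≤fromℕ (φ n)) (begin
      ∣ μ n ℚ.* φ₂ n ∣         ≡⟨ ℚP.∣p*q∣≡∣p∣*∣q∣ (μ n) (φ₂ n) ⟩
      ∣ μ n ∣ ℚ.* ∣ φ₂ n ∣     ≤⟨ *-monoʳ-≤-nonneg (ℚP.0≤∣p∣ (φ₂ n)) (∣μ∣≤1 n) ⟩
      1ℚ ℚ.* ∣ φ₂ n ∣          ≡⟨ ℚP.*-identityˡ _ ⟩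
      ∣ φ₂ n ∣                 ∎)
      where open ℚP.≤-Reasoning

  G≡∑ : ∀ τ z z₀ → G τ z z₀ ≡ ∑ (λ ℓ → if (fromℕ ℓ ℚ.≤ᵇ z) ∧ coprimeᵇ ℓ (τ * P z₀) then h ℓ else 0ℚ) (floorℕ z)
  G≡∑ τ z z₀ = trans (sumq-filterᵇ _ h (range (floorℕ z))) (foldr-+-range _ (floorℕ z))

  Gbr≡∑ : ∀ q z z₀ τ → Gbr q z z₀ τ ≡
    ∑ (λ ℓ → if (fromℕ (ℓ * ℓ * q) ℚ.≤ᵇ (z ℚ.* z)) ∧ coprimeᵇ ℓ (q * τ * P z₀)
             then h ℓ ℚ.* ξ q (divq z (fromℕ ℓ)) else 0ℚ) (floorℕ z)
  Gbr≡∑ q z z₀ τ =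
    trans (sumq-filterᵇ _ (λ ℓ → h ℓ ℚ.* ξ q (divq z (fromℕ ℓ))) (range (floorℕ z))) (foldr-+-range _ (floorℕ z))

  G-nonneg : ∀ τ z z₀ → 0ℚ ℚ.≤ G τ z z₀
  G-nonneg τ z z₀ = subst (0ℚ ℚ.≤_) (sym (G≡∑ τ z z₀))
    (∑-nonneg (floorℕ z) (λ ℓ _ _ → if-nonneg ((fromℕ ℓ ℚ.≤ᵇ z) ∧ coprimeᵇ ℓ (τ * P z₀)) (h-nonneg ℓ)))

  ≤-from-squares : ∀ {p q} → 0ℚ ℚ.≤ q → p ℚ.* p ℚ.≤ q ℚ.* q → p ℚ.≤ q
  ≤-from-squares {p} {q} 0≤q pp≤qq = ℚP.≮⇒≥ (λ q<p → ℚP.<-irrefl refl (begin-strict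
    p ℚ.* p     ≤⟨ pp≤qq ⟩
    q ℚ.* q     ≤⟨ *-monoˡ-≤-nonneg 0≤q (ℚP.<⇒≤ q<p) ⟩
    q ℚ.* p     <⟨ ℚP.*-monoˡ-<-pos p {{ℚ.positive (ℚP.≤-<-trans 0≤q q<p)}} q<p ⟩
    p ℚ.* p     ∎))
    where open ℚP.≤-Reasoning

  coprimeᵇ-*ˡ : ∀ ℓ q t → T (coprimeᵇ ℓ (q * t)) → T (coprimeᵇ ℓ t)
  coprimeᵇ-*ˡ ℓ q t c = ℕP.≡⇒≡ᵇ (gcd ℓ t) 1 (C.coprime⇒gcd≡1 {ℓ} {t} (λ (d∣ℓ , d∣t) →
    C.gcd≡1⇒coprime {ℓ} {q * t} (ℕP.≡ᵇ⇒≡ (gcd ℓ (q * t)) 1 c) (d∣ℓ , ∣n⇒∣m*n q d∣t)))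

  Gbr-range⊆G-range : ∀ {q z z₀ τ ℓ} → 1 ≤ q → 1 ≤ ℓ → 0ℚ ℚ.≤ z →
    T ((fromℕ (ℓ * ℓ * q) ℚ.≤ᵇ (z ℚ.* z)) ∧ coprimeᵇ ℓ (q * τ * P z₀)) →
    T ((fromℕ ℓ ℚ.≤ᵇ z) ∧ coprimeᵇ ℓ (τ * P z₀))
  Gbr-range⊆G-range {q} {z} {z₀} {τ} {ℓ} 1≤q 1≤ℓ 0≤z t = Equivalence.from T-∧ (ℚP.≤⇒≤ᵇ ℓ≤z , coprime)
    where
    ℓ²q≤z² : T (fromℕ (ℓ * ℓ * q) ℚ.≤ᵇ (z ℚ.* z))
    ℓ²q≤z² = proj₁ (Equivalence.to T-∧ t)
    coprime[ℓ,qτP] : T (coprimeᵇ ℓ (q * τ * P z₀))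
    coprime[ℓ,qτP] = proj₂ (Equivalence.to (T-∧ {fromℕ (ℓ * ℓ * q) ℚ.≤ᵇ (z ℚ.* z)}) t)
    ℓ≤z : fromℕ ℓ ℚ.≤ z
    ℓ≤z = ≤-from-squares 0≤z (subst (ℚ._≤ z ℚ.* z) (fromℕ-* ℓ ℓ)
      (ℚP.≤-trans (fromℕ-mono-≤ (ℕP.m≤m*n (ℓ * ℓ) q {{ℕ.>-nonZero 1≤q}})) (ℚP.≤ᵇ⇒≤ ℓ²q≤z²)))
    coprime : T (coprimeᵇ ℓ (τ * P z₀))
    coprime = coprimeᵇ-*ˡ ℓ q (τ * P z₀) (subst (T ∘ coprimeᵇ ℓ) (ℕP.*-assoc q τ (P z₀)) coprime[ℓ,qτP])

  if-*ʳ : ∀ (β : Bool) r x → (if β then r ℚ.* x else 0ℚ) ≡ r ℚ.* (if β then x else 0ℚ)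
  if-*ʳ true r x = refl
  if-*ʳ false r x = sym (ℚP.*-zeroʳ r)

  ∣Gbr∣≤Ξ*G : ∀ q z z₀ τ → 1 ≤ q → 0ℚ ℚ.≤ z → ∣ Gbr q z z₀ τ ∣ ℚ.≤ Ξ q ℚ.* G τ z z₀
  ∣Gbr∣≤Ξ*G q z z₀ τ 1≤q 0≤z = begin
    ∣ Gbr q z z₀ τ ∣
      ≡⟨ cong ∣_∣ (Gbr≡∑ q z z₀ τ) ⟩
    ∣ ∑ _ (floorℕ z) ∣
      ≤⟨ ∣∑∣≤∑ (floorℕ z) (λ ℓ 1≤ℓ _ → ∣if∣≤if (inGbr ℓ) (inG ℓ)
           (Gbr-range⊆G-range {q} {z} {z₀} {τ} 1≤q 1≤ℓ 0≤z) (∣term∣≤Ξ*h ℓ)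
           (*-nonneg (Ξ-nonneg q) (h-nonneg ℓ))) ⟩
    ∑ (λ ℓ → if inG ℓ then Ξ q ℚ.* h ℓ else 0ℚ) (floorℕ z)
      ≡⟨ ∑-cong (floorℕ z) (λ ℓ _ _ → if-*ʳ (inG ℓ) (Ξ q) (h ℓ)) ⟩
    ∑ (λ ℓ → Ξ q ℚ.* (if inG ℓ then h ℓ else 0ℚ)) (floorℕ z)
      ≡⟨ ∑-scale (Ξ q) _ (floorℕ z) ⟩
    Ξ q ℚ.* ∑ (λ ℓ → if inG ℓ then h ℓ else 0ℚ) (floorℕ z)
      ≡⟨ cong (Ξ q ℚ.*_) (G≡∑ τ z z₀) ⟨
    Ξ q ℚ.* G τ z z₀
      ∎
    where
    open ℚP.≤-Reasoning
    inG inGbr : ℕ → Bool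
    inG ℓ = (fromℕ ℓ ℚ.≤ᵇ z) ∧ coprimeᵇ ℓ (τ * P z₀)
    inGbr ℓ = (fromℕ (ℓ * ℓ * q) ℚ.≤ᵇ (z ℚ.* z)) ∧ coprimeᵇ ℓ (q * τ * P z₀)
    ∣term∣≤Ξ*h : ∀ ℓ → ∣ h ℓ ℚ.* ξ q (divq z (fromℕ ℓ)) ∣ ℚ.≤ Ξ q ℚ.* h ℓ
    ∣term∣≤Ξ*h ℓ = begin
      ∣ h ℓ ℚ.* ξ q (divq z (fromℕ ℓ)) ∣       ≡⟨ ℚP.∣p*q∣≡∣p∣*∣q∣ (h ℓ) (ξ q (divq z (fromℕ ℓ))) ⟩
      ∣ h ℓ ∣ ℚ.* ∣ ξ q (divq z (fromℕ ℓ)) ∣   ≡⟨ cong (ℚ._* ∣ ξ q (divq z (fromℕ ℓ)) ∣) (ℚP.0≤p⇒∣p∣≡p (h-nonneg ℓ)) ⟩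
      h ℓ ℚ.* ∣ ξ q (divq z (fromℕ ℓ)) ∣       ≤⟨ *-monoˡ-≤-nonneg (h-nonneg ℓ) (∣ξ∣≤Ξ q (divq z (fromℕ ℓ))) ⟩
      h ℓ ℚ.* Ξ q                              ≡⟨ ℚP.*-comm (h ℓ) (Ξ q) ⟩
      Ξ q ℚ.* h ℓ                              ∎

  -- Squarefree numbers without small prime factors

  record SquarefreeRough (L q : ℕ) : Set where
    field
      positive : 1 ≤ q
      rough : ∀ {p} → Prime p → p ∣ q → L ≤ p
      squarefree : ∀ {p} → Prime p → p ∣ q → ¬ p * p ∣ q

  ∃-prime-divisor : ∀ n → 2 ≤ n → ∃[ p ] Prime p × p ∣ n
  ∃-prime-divisor = <-rec (λ n → 2 ≤ n → ∃[ p ] Prime p × p ∣ n) go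
    where
    go : ∀ n → (∀ {m} → m < n → 2 ≤ m → ∃[ p ] Prime p × p ∣ m) → 2 ≤ n → ∃[ p ] Prime p × p ∣ n
    go n rec 2≤n with prime? n
    ... | yes pr = n , pr , ∣-refl
    ... | no ¬pr with ¬prime⇒composite {{ℕ.n>1⇒nonTrivial 2≤n}} ¬pr
    ...   | hasNonTrivialDivisor {d} d<n d∣n with rec d<n (ℕ.nonTrivial⇒n>1 d)
    ...     | p , pr , p∣d = p , pr , ∣-trans p∣d d∣n

  SquarefreeRough-induction : ∀ L (Q : ℕ → Set) → Q 1 →
    (∀ {p m} → Prime p → ¬ p ∣ m → L ≤ p → SquarefreeRough L m → Q m → Q (p * m)) →
    ∀ q → SquarefreeRough L q → Q q
  SquarefreeRough-induction L Q base step = <-rec (λ q → SquarefreeRough L q → Q q) go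
    where
    go : ∀ q → (∀ {m} → m < q → SquarefreeRough L m → Q m) → SquarefreeRough L q → Q q
    go 0 _ sr = ⊥-elim (ℕP.n≮0 (SquarefreeRough.positive sr))
    go 1 _ _ = base
    go q@(suc (suc _)) rec sr with ∃-prime-divisor q (s≤s (s≤s z≤n))
    ... | p , pr , p∣q = subst Q (sym q≡p*m) (step pr p∤m (rough pr p∣q) srm (rec m<q srm))
      where
      open SquarefreeRough sr
      instance _ = prime⇒nonZero pr
      m : ℕ
      m = quotient p∣q
      q≡p*m : q ≡ p * m
      q≡p*m = m∣n⇒n≡m*quotient p∣q
      m∣q : m ∣ q
      m∣q = divides p q≡p*m
      1≤m : 1 ≤ m
      1≤m = ℕP.n≢0⇒n>0 (λ m≡0 → ℕP.0≢1+n (sym (trans q≡p*m (trans (cong (p *_) m≡0) (ℕP.*-zeroʳ p)))))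
      p∤m : ¬ p ∣ m
      p∤m p∣m = squarefree pr p∣q (subst (p * p ∣_) (sym q≡p*m) (*-monoʳ-∣ p p∣m))
      srm : SquarefreeRough L m
      srm = record
        { positive = 1≤m
        ; rough = λ pr′ p′∣m → rough pr′ (∣-trans p′∣m m∣q)
        ; squarefree = λ pr′ p′∣m p′²∣m → squarefree pr′ (∣-trans p′∣m m∣q) (∣-trans p′²∣m m∣q)
        }
      m<q : m < q
      m<q = subst (m <_) (trans (ℕP.*-comm m p) (sym q≡p*m))
        (ℕP.m<m*n m p {{ℕ.>-nonZero 1≤m}} (ℕ.nonTrivial⇒n>1 p {{prime⇒nonTrivial pr}}))

  power-bound-step : ∀ e₁ e₂ {s y′ y c x′ x f g k : ℚ} → 0ℚ ℚ.< s → s ℚ.* y′ ≡ c ℚ.* y →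
    0ℚ ℚ.≤ powq c e₁ ℚ.* powq x′ e₂ → 0ℚ ℚ.≤ k ℚ.* powq f e₁ →
    powq y e₁ ℚ.* powq x e₂ ℚ.≤ k ℚ.* powq f e₁ →
    powq c e₁ ℚ.* powq x′ e₂ ℚ.≤ g ℚ.* (powq s e₁ ℚ.* powq s e₁) →
    powq y′ e₁ ℚ.* powq (x′ ℚ.* x) e₂ ℚ.≤ (g ℚ.* k) ℚ.* powq (s ℚ.* f) e₁
  power-bound-step e₁ e₂ {s} {y′} {y} {c} {x′} {x} {f} {g} {k} 0<s sy′≡cy 0≤cx′ 0≤kf bound local =
    ℚP.*-cancelˡ-≤-pos S {{ℚ.positive (powq-pos e₁ 0<s)}} (begin
      S ℚ.* (powq y′ e₁ ℚ.* powq (x′ ℚ.* x) e₂)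
        ≡⟨ cong (λ t → S ℚ.* (powq y′ e₁ ℚ.* t)) (powq-* x′ x e₂) ⟩
      S ℚ.* (powq y′ e₁ ℚ.* (X′ ℚ.* X))
        ≡⟨ solve 4 (λ S y p m → S :* (y :* (p :* m)) := (S :* y) :* (p :* m)) refl S (powq y′ e₁) X′ X ⟩
      (S ℚ.* powq y′ e₁) ℚ.* (X′ ℚ.* X)
        ≡⟨ cong (ℚ._* (X′ ℚ.* X)) (trans (sym (powq-* s y′ e₁)) (trans (cong (λ t → powq t e₁) sy′≡cy) (powq-* c y e₁))) ⟩
      (C ℚ.* powq y e₁) ℚ.* (X′ ℚ.* X)
        ≡⟨ solve 4 (λ c y p m → (c :* y) :* (p :* m) := (c :* p) :* (y :* m)) refl C (powq y e₁) X′ X ⟩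
      (C ℚ.* X′) ℚ.* (powq y e₁ ℚ.* X)
        ≤⟨ *-monoˡ-≤-nonneg 0≤cx′ bound ⟩
      (C ℚ.* X′) ℚ.* (k ℚ.* F)
        ≤⟨ *-monoʳ-≤-nonneg 0≤kf local ⟩
      (g ℚ.* (S ℚ.* S)) ℚ.* (k ℚ.* F)
        ≡⟨ solve 4 (λ g S k f → (g :* (S :* S)) :* (k :* f) := S :* ((g :* k) :* (S :* f))) refl g S k F ⟩
      S ℚ.* ((g ℚ.* k) ℚ.* (S ℚ.* F))
        ≡⟨ cong (λ t → S ℚ.* ((g ℚ.* k) ℚ.* t)) (powq-* s f e₁) ⟨
      S ℚ.* ((g ℚ.* k) ℚ.* powq (s ℚ.* f) e₁)
        ∎)
    where
    open ℚP.≤-Reasoning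
    open +-*-Solver
    S C F X′ X : ℚ
    S = powq s e₁
    C = powq c e₁
    F = powq f e₁
    X′ = powq x′ e₂
    X = powq x e₂

  LocalFactorBound : ℕ → ℕ → (ℕ → ℚ) → ℕ → Set
  LocalFactorBound e₁ e₂ K p = powq (fromℕ (3 * p ∸ 4)) e₁ ℚ.* powq (fromℕ p) e₂
    ℚ.≤ K p ℚ.* (powq (fromℕ (p ∸ 1)) e₁ ℚ.* powq (fromℕ (p ∸ 1)) e₁)

  Ξ-power-bound : ∀ L e₁ e₂ (K : ℕ → ℚ) → 1ℚ ℚ.≤ K 1 → (∀ m → 0ℚ ℚ.≤ K m) →
    (∀ {p m} → Prime p → ¬ p ∣ m → K (p * m) ≡ K p ℚ.* K m) →
    (∀ {p} → Prime p → L ≤ p → LocalFactorBound e₁ e₂ K p) →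
    ∀ q → SquarefreeRough L q → powq (Ξ q) e₁ ℚ.* powq (fromℕ q) e₂ ℚ.≤ K q ℚ.* powq (fromℕ (φ q)) e₁
  Ξ-power-bound L e₁ e₂ K 1≤K[1] 0≤K K-multiplicative local = SquarefreeRough-induction L Bound base step
    where
    open ℚP.≤-Reasoning
    Bound : ℕ → Set
    Bound q = powq (Ξ q) e₁ ℚ.* powq (fromℕ q) e₂ ℚ.≤ K q ℚ.* powq (fromℕ (φ q)) e₁
    base : Bound 1
    base = begin
      powq 1ℚ e₁ ℚ.* powq 1ℚ e₂     ≡⟨ cong₂ ℚ._*_ (powq-1 e₁) (powq-1 e₂) ⟩
      1ℚ                            ≤⟨ 1≤K[1] ⟩
      K 1                           ≡⟨ ℚP.*-identityʳ (K 1) ⟨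
      K 1 ℚ.* 1ℚ                    ≡⟨ cong (K 1 ℚ.*_) (powq-1 e₁) ⟨
      K 1 ℚ.* powq 1ℚ e₁            ∎
    step : ∀ {p m} → Prime p → ¬ p ∣ m → L ≤ p → SquarefreeRough L m → Bound m → Bound (p * m)
    step {p} {m} pr p∤m L≤p srm IH = begin
      powq (Ξ (p * m)) e₁ ℚ.* powq (fromℕ (p * m)) e₂
        ≡⟨ cong (λ t → powq (Ξ (p * m)) e₁ ℚ.* powq t e₂) (fromℕ-* p m) ⟩
      powq (Ξ (p * m)) e₁ ℚ.* powq (fromℕ p ℚ.* fromℕ m) e₂
        ≤⟨ power-bound-step e₁ e₂ {fromℕ (p ∸ 1)} {Ξ (p * m)} {Ξ m} {fromℕ (3 * p ∸ 4)}
             {fromℕ p} {fromℕ m} {fromℕ (φ m)} {K p} {K m}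
             0<p∸1 (Ξ-recurrence {{ℕ.>-nonZero (SquarefreeRough.positive srm)}} pr p∤m)
             (*-nonneg (powq-nonneg e₁ (0≤fromℕ (3 * p ∸ 4))) (powq-nonneg e₂ (0≤fromℕ p)))
             (*-nonneg (0≤K m) (powq-nonneg e₁ (0≤fromℕ (φ m)))) IH (local pr L≤p) ⟩
      (K p ℚ.* K m) ℚ.* powq (fromℕ (p ∸ 1) ℚ.* fromℕ (φ m)) e₁
        ≡⟨ cong₂ (λ a b → a ℚ.* powq b e₁) (K-multiplicative pr p∤m) φ[pm]≡ ⟨
      K (p * m) ℚ.* powq (fromℕ (φ (p * m))) e₁
        ∎
      where
      0<p∸1 : 0ℚ ℚ.< fromℕ (p ∸ 1)
      0<p∸1 = 0<fromℕ (p ∸ 1) {{ℕ.>-nonZero (ℕP.m<n⇒0<n∸m (prime⇒2≤p pr))}}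
      φ[pm]≡ : fromℕ (φ (p * m)) ≡ fromℕ (p ∸ 1) ℚ.* fromℕ (φ m)
      φ[pm]≡ = trans (cong fromℕ (φ-*-prime pr p∤m)) (fromℕ-* (p ∸ 1) (φ m))

  -- Local factors at primes

  ^-distribʳ-* : ∀ m n o → (m * n) ^ o ≡ m ^ o * n ^ o
  ^-distribʳ-* m n zero = refl
  ^-distribʳ-* m n (suc o) = trans (cong (m * n *_) (^-distribʳ-* m n o))
    (solve 4 (λ m n x y → m :* n :* (x :* y) := m :* x :* (n :* y)) refl m n (m ^ o) (n ^ o))
    where open ℕ-Solver.+-*-Solver

  -- For p > L we have p ≤ (L + 1)/L · (p - 1) and p ≥ L + 1, so 3^(d+e) p^e ≤ (p - 1)^(d+e)
  -- reduces to the numerical condition at p = L + 1; and 3p - 4 ≤ 3(p - 1).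
  3p∸4-power-bound : ∀ L d e {p} → suc L ≤ p → 3 ^ (d + e) * suc L ^ (d + e) ≤ L ^ (d + e) * suc L ^ d →
    (3 * p ∸ 4) ^ (d + e) * p ^ e ≤ (p ∸ 1) ^ (d + e) * (p ∸ 1) ^ (d + e)
  3p∸4-power-bound L d e {suc a} (s≤s L≤a) numerical = begin
    (3 * suc a ∸ 4) ^ e₁ * suc a ^ e
      ≤⟨ ℕP.*-monoˡ-≤ (suc a ^ e) (ℕP.^-monoˡ-≤ e₁ 3p∸4≤3a) ⟩
    (3 * a) ^ e₁ * suc a ^ e
      ≡⟨ cong (_* suc a ^ e) (^-distribʳ-* 3 a e₁) ⟩
    3 ^ e₁ * a ^ e₁ * suc a ^ e
      ≡⟨ solve 3 (λ t x y → t :* x :* y := t :* y :* x) refl (3 ^ e₁) (a ^ e₁) (suc a ^ e) ⟩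
    3 ^ e₁ * suc a ^ e * a ^ e₁
      ≤⟨ ℕP.*-monoˡ-≤ (a ^ e₁) (ℕP.*-cancelˡ-≤ K scaled) ⟩
    a ^ e₁ * a ^ e₁
      ∎
    where
    open ℕP.≤-Reasoning
    open ℕ-Solver.+-*-Solver
    e₁ K : ℕ
    e₁ = d + e
    K = suc L ^ e₁
    instance _ = ℕ.>-nonZero (ℕP.m^n>0 (suc L) e₁)
    3p∸4≤3a : 3 * suc a ∸ 4 ≤ 3 * a
    3p∸4≤3a = ℕP.≤-trans (ℕP.∸-monoʳ-≤ (3 * suc a) (ℕP.n≤1+n 3)) (ℕP.≤-reflexive (cong (_∸ 3) (ℕP.*-suc 3 a)))
    L*p≤[L+1]*a : L * suc a ≤ suc L * a
    L*p≤[L+1]*a = begin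
      L * suc a      ≡⟨ ℕP.*-suc L a ⟩
      L + L * a      ≤⟨ ℕP.+-monoˡ-≤ (L * a) L≤a ⟩
      a + L * a      ∎
    scaled : K * (3 ^ e₁ * suc a ^ e) ≤ K * a ^ e₁
    scaled = begin
      K * (3 ^ e₁ * suc a ^ e)
        ≡⟨ solve 3 (λ k t y → k :* (t :* y) := t :* k :* y) refl K (3 ^ e₁) (suc a ^ e) ⟩
      3 ^ e₁ * K * suc a ^ e
        ≤⟨ ℕP.*-monoˡ-≤ (suc a ^ e) numerical ⟩
      L ^ e₁ * suc L ^ d * suc a ^ e
        ≤⟨ ℕP.*-monoˡ-≤ (suc a ^ e) (ℕP.*-monoʳ-≤ (L ^ e₁) (ℕP.^-monoˡ-≤ d (s≤s L≤a))) ⟩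
      L ^ e₁ * suc a ^ d * suc a ^ e
        ≡⟨ ℕP.*-assoc (L ^ e₁) (suc a ^ d) (suc a ^ e) ⟩
      L ^ e₁ * (suc a ^ d * suc a ^ e)
        ≡⟨ cong (L ^ e₁ *_) (ℕP.^-distribˡ-+-* (suc a) d e) ⟨
      L ^ e₁ * suc a ^ e₁
        ≡⟨ ^-distribʳ-* L (suc a) e₁ ⟨
      (L * suc a) ^ e₁
        ≤⟨ ℕP.^-monoˡ-≤ e₁ L*p≤[L+1]*a ⟩
      (suc L * a) ^ e₁
        ≡⟨ ^-distribʳ-* (suc L) a e₁ ⟩
      K * a ^ e₁
        ∎

  fromℕ-bound : ∀ x y u e₁ e₂ → x ^ e₁ * y ^ e₂ ≤ u ^ e₁ * u ^ e₁ →
    powq (fromℕ x) e₁ ℚ.* powq (fromℕ y) e₂ ℚ.≤ powq (fromℕ u) e₁ ℚ.* powq (fromℕ u) e₁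
  fromℕ-bound x y u e₁ e₂ le = subst₂ ℚ._≤_ (sym (cast x y e₂)) (sym (cast u u e₁)) (fromℕ-mono-≤ le)
    where
    cast : ∀ a b e → powq (fromℕ a) e₁ ℚ.* powq (fromℕ b) e ≡ fromℕ (a ^ e₁ * b ^ e)
    cast a b e = trans (cong₂ ℚ._*_ (powq-fromℕ a e₁) (powq-fromℕ b e)) (sym (fromℕ-* (a ^ e₁) (b ^ e)))

  LocalFactorBound-beyond : ∀ L d e (K : ℕ → ℚ) {p} → suc L ≤ p → 1ℚ ℚ.≤ K p →
    3 ^ (d + e) * suc L ^ (d + e) ≤ L ^ (d + e) * suc L ^ d → LocalFactorBound (d + e) e K p
  LocalFactorBound-beyond L d e K {p} L<p 1≤Kp numerical = begin
    powq (fromℕ (3 * p ∸ 4)) e₁ ℚ.* powq (fromℕ p) e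
      ≤⟨ fromℕ-bound (3 * p ∸ 4) p (p ∸ 1) e₁ e (3p∸4-power-bound L d e L<p numerical) ⟩
    [p∸1]^2e₁
      ≡⟨ ℚP.*-identityˡ [p∸1]^2e₁ ⟨
    1ℚ ℚ.* [p∸1]^2e₁
      ≤⟨ *-monoʳ-≤-nonneg (*-nonneg (powq-nonneg e₁ (0≤fromℕ (p ∸ 1))) (powq-nonneg e₁ (0≤fromℕ (p ∸ 1)))) 1≤Kp ⟩
    K p ℚ.* [p∸1]^2e₁
      ∎
    where
    open ℚP.≤-Reasoning
    e₁ : ℕ
    e₁ = d + e
    [p∸1]^2e₁ : ℚ
    [p∸1]^2e₁ = powq (fromℕ (p ∸ 1)) e₁ ℚ.* powq (fromℕ (p ∸ 1)) e₁

  ≥-elim : ∀ (P : ℕ → Set) m {n} → m ≤ n → (∀ j → P (m + j)) → P n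
  ≥-elim P m {n} m≤n P[m+_] = subst P (ℕP.m+[n∸m]≡n m≤n) P[m+ (n ∸ m) ]

  prime≥29 : ∀ {p} → Prime p → 29 ≤ p → p ≡ 29 ⊎ 31 ≤ p
  prime≥29 pr 29≤p = ≥-elim (λ n → Prime n → n ≡ 29 ⊎ 31 ≤ n) 29 29≤p cases pr
    where
    cases : ∀ j → Prime (29 + j) → 29 + j ≡ 29 ⊎ 31 ≤ 29 + j
    cases 0 _ = inj₁ refl
    cases 1 pr = contradiction pr (from-no (prime? 30))
    cases (suc (suc j)) _ = inj₂ (ℕP.m≤m+n 31 j)

  local-bound-29 : ∀ {p} → Prime p → 29 ≤ p → LocalFactorBound 3 2 (λ _ → 1ℚ) p
  local-bound-29 pr 29≤p = [ (λ p≡29 → subst (LocalFactorBound 3 2 (λ _ → 1ℚ)) (sym p≡29) (ℚP.≤ᵇ⇒≤ tt))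
                           , (λ 31≤p → LocalFactorBound-beyond 30 1 2 (λ _ → 1ℚ) 31≤p ℚP.≤-refl (ℕP.≤ᵇ⇒≤ _ _ tt))
                           ]′ (prime≥29 pr 29≤p)

  κ : ℕ → ℚ → ℕ → ℚ
  κ r X m = if does (r ∣? m) then X else 1ℚ

  κ-*-prime : ∀ {r p m} X → Prime r → Prime p → ¬ p ∣ m → κ r X (p * m) ≡ κ r X p ℚ.* κ r X m
  κ-*-prime {r} {p} {m} X prr prp p∤m with r ∣? p
  ... | yes r∣p with prime⇒irreducible prp r∣p
  ...   | inj₁ r≡1 = ⊥-elim (ℕ.nonTrivial⇒≢1 {{prime⇒nonTrivial prr}} r≡1)
  ...   | inj₂ refl = begin
    κ p X (p * m)     ≡⟨ if-does-yes (p ∣? p * m) (m∣m*n m) ⟩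
    X                 ≡⟨ ℚP.*-identityʳ X ⟨
    X ℚ.* 1ℚ          ≡⟨ cong (X ℚ.*_) (if-does-no (p ∣? m) p∤m) ⟨
    X ℚ.* κ p X m     ∎
    where open ≡-Reasoning
  κ-*-prime {r} {p} {m} X prr prp p∤m | no r∤p = begin
    κ r X (p * m)
      ≡⟨ cong (if_then X else 1ℚ) (does-⇔ (mk⇔ (prime∣m*n∧∤m⇒∣n prr r∤p) (∣n⇒∣m*n p)) (r ∣? p * m) (r ∣? m)) ⟩
    κ r X m
      ≡⟨ ℚP.*-identityˡ (κ r X m) ⟨
    1ℚ ℚ.* κ r X m
      ∎
    where open ≡-Reasoning

  κ-nonneg : ∀ r {X} m → 0ℚ ℚ.≤ X → 0ℚ ℚ.≤ κ r X m
  κ-nonneg r m 0≤X with does (r ∣? m)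
  ... | true = 0≤X
  ... | false = ℚP.≤ᵇ⇒≤ tt

  1≤κ : ∀ r {X} m → 1ℚ ℚ.≤ X → 1ℚ ℚ.≤ κ r X m
  1≤κ r m 1≤X with does (r ∣? m)
  ... | true = 1≤X
  ... | false = ℚP.≤-refl

  κ≤ : ∀ r {X} m → 1ℚ ℚ.≤ X → κ r X m ℚ.≤ X
  κ≤ r m 1≤X with does (r ∣? m)
  ... | true = ℚP.≤-refl
  ... | false = 1≤X

  -- For primes p ≥ 43, (3p - 4)^10 p^7 ≤ (p - 1)^20; the two exceptional primes 37 and 41
  -- are compensated by the factors 1.035^10 and 1.001^10.
  κ₃₇ κ₄₁ K₃₇,₄₁ : ℕ → ℚ
  κ₃₇ = κ 37 (powq (+ 1035 ℚ./ 1000) 10)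
  κ₄₁ = κ 41 (powq (+ 1001 ℚ./ 1000) 10)
  K₃₇,₄₁ m = κ₃₇ m ℚ.* κ₄₁ m

  K₃₇,₄₁-nonneg : ∀ m → 0ℚ ℚ.≤ K₃₇,₄₁ m
  K₃₇,₄₁-nonneg m = *-nonneg (κ-nonneg 37 m (ℚP.≤ᵇ⇒≤ tt)) (κ-nonneg 41 m (ℚP.≤ᵇ⇒≤ tt))

  1≤K₃₇,₄₁ : ∀ m → 1ℚ ℚ.≤ K₃₇,₄₁ m
  1≤K₃₇,₄₁ m = begin
    1ℚ ℚ.* 1ℚ         ≤⟨ *-monoʳ-≤-nonneg (ℚP.≤ᵇ⇒≤ tt) (1≤κ 37 m (ℚP.≤ᵇ⇒≤ tt)) ⟩
    κ₃₇ m ℚ.* 1ℚ      ≤⟨ *-monoˡ-≤-nonneg (κ-nonneg 37 m (ℚP.≤ᵇ⇒≤ tt)) (1≤κ 41 m (ℚP.≤ᵇ⇒≤ tt)) ⟩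
    κ₃₇ m ℚ.* κ₄₁ m   ∎
    where open ℚP.≤-Reasoning

  K₃₇,₄₁-multiplicative : ∀ {p m} → Prime p → ¬ p ∣ m → K₃₇,₄₁ (p * m) ≡ K₃₇,₄₁ p ℚ.* K₃₇,₄₁ m
  K₃₇,₄₁-multiplicative {p} {m} pr p∤m = trans
    (cong₂ ℚ._*_ (κ-*-prime _ (from-yes (prime? 37)) pr p∤m) (κ-*-prime _ (from-yes (prime? 41)) pr p∤m))
    (solve 4 (λ a b x y → (a :* x) :* (b :* y) := (a :* b) :* (x :* y)) refl (κ₃₇ p) (κ₄₁ p) (κ₃₇ m) (κ₄₁ m))
    where open +-*-Solver

  K₃₇,₄₁≤1·04^10 : ∀ m → K₃₇,₄₁ m ℚ.≤ powq (+ 104 ℚ./ 100) 10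
  K₃₇,₄₁≤1·04^10 m = begin
    κ₃₇ m ℚ.* κ₄₁ m
      ≤⟨ *-monoʳ-≤-nonneg (κ-nonneg 41 m (ℚP.≤ᵇ⇒≤ tt)) (κ≤ 37 m (ℚP.≤ᵇ⇒≤ tt)) ⟩
    powq (+ 1035 ℚ./ 1000) 10 ℚ.* κ₄₁ m
      ≤⟨ *-monoˡ-≤-nonneg (ℚP.≤ᵇ⇒≤ tt) (κ≤ 41 m (ℚP.≤ᵇ⇒≤ tt)) ⟩
    powq (+ 1035 ℚ./ 1000) 10 ℚ.* powq (+ 1001 ℚ./ 1000) 10
      ≤⟨ ℚP.≤ᵇ⇒≤ tt ⟩
    powq (+ 104 ℚ./ 100) 10
      ∎
    where open ℚP.≤-Reasoning

  prime≥37 : ∀ {p} → Prime p → 37 ≤ p → p ≡ 37 ⊎ p ≡ 41 ⊎ 43 ≤ p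
  prime≥37 pr 37≤p = ≥-elim (λ n → Prime n → n ≡ 37 ⊎ n ≡ 41 ⊎ 43 ≤ n) 37 37≤p cases pr
    where
    cases : ∀ j → Prime (37 + j) → 37 + j ≡ 37 ⊎ 37 + j ≡ 41 ⊎ 43 ≤ 37 + j
    cases 0 _ = inj₁ refl
    cases 1 pr = contradiction pr (from-no (prime? 38))
    cases 2 pr = contradiction pr (from-no (prime? 39))
    cases 3 pr = contradiction pr (from-no (prime? 40))
    cases 4 _ = inj₂ (inj₁ refl)
    cases 5 pr = contradiction pr (from-no (prime? 42))
    cases (suc (suc (suc (suc (suc (suc j)))))) _ = inj₂ (inj₂ (ℕP.m≤m+n 43 j))

  local-bound-37 : ∀ {p} → Prime p → 37 ≤ p → LocalFactorBound 10 7 K₃₇,₄₁ p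
  local-bound-37 {p} pr 37≤p =
    [ (λ p≡37 → subst (LocalFactorBound 10 7 K₃₇,₄₁) (sym p≡37) (ℚP.≤ᵇ⇒≤ tt))
    , [ (λ p≡41 → subst (LocalFactorBound 10 7 K₃₇,₄₁) (sym p≡41) (ℚP.≤ᵇ⇒≤ tt))
      , (λ 43≤p → LocalFactorBound-beyond 42 3 7 K₃₇,₄₁ 43≤p (1≤K₃₇,₄₁ p) (ℕP.≤ᵇ⇒≤ _ _ tt))
      ]′
    ]′ (prime≥37 pr 37≤p)

  -- Sifting by P(z₀)

  [1+n]/d≤∣-[1+n]/d∣ : ∀ n d .{{_ : NonZero d}} → suc n ℕ./ d ≤ ℤ.∣ -[1+ n ] ℤ./ℕ d ∣
  [1+n]/d≤∣-[1+n]/d∣ n d with suc n ℕ.% d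
  ... | zero = ℕP.≤-reflexive (sym (ℤP.∣-i∣≡∣i∣ (+ (suc n ℕ./ d))))
  ... | suc _ = ℕP.n≤1+n _

  fromℕ≤⇒≤ceilℕ : ∀ {B} z₀ → fromℕ B ℚ.≤ z₀ → B ≤ ceilℕ z₀
  fromℕ≤⇒≤ceilℕ {zero} _ _ = z≤n
  fromℕ≤⇒≤ceilℕ {suc B} z₀@(mkℚ (+ zero) _ _) B≤z₀ with ℚP.drop-*≤* (subst (ℚ._≤ z₀) (fromℕ≡mkℚ (suc B)) B≤z₀)
  ... | ℤ.+≤+ ()
  fromℕ≤⇒≤ceilℕ {suc B} z₀@(mkℚ -[1+ _ ] _ _) B≤z₀ with ℚP.drop-*≤* (subst (ℚ._≤ z₀) (fromℕ≡mkℚ (suc B)) B≤z₀)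
  ... | ()
  fromℕ≤⇒≤ceilℕ {suc B} z₀@(mkℚ (+ suc n) d-1 _) B≤z₀ = begin
    suc B                               ≡⟨ ℕ-DivMod.m*n/n≡m (suc B) (suc d-1) ⟨
    suc B * suc d-1 ℕ./ suc d-1         ≤⟨ ℕ-DivMod./-monoˡ-≤ (suc d-1) B*d≤n ⟩
    suc n ℕ./ suc d-1                   ≤⟨ [1+n]/d≤∣-[1+n]/d∣ n (suc d-1) ⟩
    ℤ.∣ -[1+ n ] ℤ./ℕ suc d-1 ∣         ≡⟨ cong ℤ.∣_∣ (ℤP.*-identityˡ (-[1+ n ] ℤ./ℕ suc d-1)) ⟨
    ℤ.∣ + 1 ℤ.* (-[1+ n ] ℤ./ℕ suc d-1) ∣   ≡⟨ ℤP.∣-i∣≡∣i∣ (+ 1 ℤ.* (-[1+ n ] ℤ./ℕ suc d-1)) ⟨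
    ceilℕ z₀                            ∎
    where
    open ℕP.≤-Reasoning
    B*d≤n : suc B * suc d-1 ≤ suc n
    B*d≤n = ℤP.drop‿+≤+ (subst₂ ℤ._≤_ (sym (ℤP.pos-* (suc B) (suc d-1))) (ℤP.*-identityʳ (+ suc n))
      (ℚP.drop-*≤* (subst (ℚ._≤ z₀) (fromℕ≡mkℚ (suc B)) B≤z₀)))

  ∈-range : ∀ {p n} → 1 ≤ p → p ≤ n → p ∈ range n
  ∈-range {suc p} _ p<n = ∈-map⁺ suc (∈-upTo⁺ p<n)

  <⇒<ᵇq : ∀ {x y} → x ℚ.< y → T (x <ᵇq y)
  <⇒<ᵇq {x} {y} x<y with y ℚ.≤ᵇ x in y≤ᵇx
  ... | true = ℚP.<-irrefl refl (ℚP.<-≤-trans x<y (ℚP.≤ᵇ⇒≤ (subst T (sym y≤ᵇx) tt)))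
  ... | false = tt

  prime<z₀⇒∣P : ∀ {p z₀} → Prime p → fromℕ p ℚ.< z₀ → p ∣ P z₀
  prime<z₀⇒∣P {p} {z₀} pr p<z₀ = ∈⇒∣product (∈-filter⁺ (T? ∘ sieved) (∈-range 1≤p p≤⌈z₀⌉)
    (Equivalence.from T-∧ (fromWitness pr , <⇒<ᵇq p<z₀)))
    where
    sieved : ℕ → Bool
    sieved p = isYes (prime? p) ∧ (fromℕ p <ᵇq z₀)
    1≤p : 1 ≤ p
    1≤p = ℕ.>-nonZero⁻¹ p {{prime⇒nonZero pr}}
    p≤⌈z₀⌉ : p ≤ ceilℕ z₀
    p≤⌈z₀⌉ = fromℕ≤⇒≤ceilℕ z₀ (ℚP.<⇒≤ p<z₀)

  coprimeᵇ⇒∤ : ∀ {q n p} → T (coprimeᵇ q n) → Prime p → p ∣ q → ¬ p ∣ n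
  coprimeᵇ⇒∤ {q} {n} cop pr p∣q p∣n = ℕ.nonTrivial⇒≢1 {{prime⇒nonTrivial pr}}
    (∣1⇒≡1 (subst (_ ∣_) (ℕP.≡ᵇ⇒≡ (gcd q n) 1 cop) (gcd-greatest p∣q p∣n)))

  coprime-to-P⇒prime-factor-≥ : ∀ {B z₀ q τ p} → fromℕ B ℚ.≤ z₀ → T (coprimeᵇ q (τ * P z₀)) → Prime p → p ∣ q → B ≤ p
  coprime-to-P⇒prime-factor-≥ {τ = τ} B≤z₀ cop pr p∣q = ℕP.≮⇒≥ (λ p<B →
    coprimeᵇ⇒∤ cop pr p∣q (∣n⇒∣m*n τ (prime<z₀⇒∣P pr (ℚP.<-≤-trans (fromℕ-mono-< p<B) B≤z₀))))

  squarefreeᵇ-sound : ∀ {q p} → T (squarefreeᵇ q) → Prime p → p ∣ q → ¬ p * p ∣ q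
  squarefreeᵇ-sound {suc q} {p} sf pr p∣q = toWitnessFalse (lookup (all⁺ _ (primesUpTo (suc q)) sf)
    (∈-filter⁺ prime? (∈-range (ℕ.>-nonZero⁻¹ p {{prime⇒nonZero pr}}) (∣⇒≤ p∣q)) pr))

  w-support⇒SquarefreeRough : ∀ {z₀ q τ} B L → fromℕ B ℚ.≤ z₀ → (∀ {p} → Prime p → B ≤ p → L ≤ p) → 1 ≤ q →
    T (squarefreeᵇ q ∧ coprimeᵇ q (τ * P z₀)) → SquarefreeRough L q
  w-support⇒SquarefreeRough {z₀} {q} {τ} B L B≤z₀ B⇒L 1≤q guard = record
    { positive = 1≤q
    ; rough = λ pr p∣q → B⇒L pr (coprime-to-P⇒prime-factor-≥ {τ = τ} B≤z₀ (proj₂ sf×cop) pr p∣q)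
    ; squarefree = squarefreeᵇ-sound (proj₁ sf×cop)
    }
    where
    sf×cop : T (squarefreeᵇ q) × T (coprimeᵇ q (τ * P z₀))
    sf×cop = Equivalence.to T-∧ guard

  prime≥24⇒≥29 : ∀ {p} → Prime p → 24 ≤ p → 29 ≤ p
  prime≥24⇒≥29 pr 24≤p = ≥-elim (λ n → Prime n → 29 ≤ n) 24 24≤p cases pr
    where
    cases : ∀ j → Prime (24 + j) → 29 ≤ 24 + j
    cases 0 pr = contradiction pr (from-no (prime? 24))
    cases 1 pr = contradiction pr (from-no (prime? 25))
    cases 2 pr = contradiction pr (from-no (prime? 26))
    cases 3 pr = contradiction pr (from-no (prime? 27))
    cases 4 pr = contradiction pr (from-no (prime? 28))
    cases (suc (suc (suc (suc (suc j))))) _ = ℕP.m≤m+n 29 j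

  prime≥35⇒≥37 : ∀ {p} → Prime p → 35 ≤ p → 37 ≤ p
  prime≥35⇒≥37 pr 35≤p = ≥-elim (λ n → Prime n → 37 ≤ n) 35 35≤p cases pr
    where
    cases : ∀ j → Prime (35 + j) → 37 ≤ 35 + j
    cases 0 pr = contradiction pr (from-no (prime? 35))
    cases 1 pr = contradiction pr (from-no (prime? 36))
    cases (suc (suc j)) _ = ℕP.m≤m+n 37 j

  -- Bounding G_τ w_q

  ∣g·μ/fg·b/g∣≤y/f : ∀ {g μ f b y} → 0ℚ ℚ.< f → 0ℚ ℚ.≤ g → ∣ μ ∣ ℚ.≤ 1ℚ → ∣ b ∣ ℚ.≤ y ℚ.* g → 0ℚ ℚ.≤ y →
    ∣ g ℚ.* (divq μ (f ℚ.* g) ℚ.* divq b g) ∣ ℚ.≤ divq y f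
  ∣g·μ/fg·b/g∣≤y/f {g} {μ} {f} {b} {y} 0<f 0≤g ∣μ∣≤1 ∣b∣≤yg 0≤y = by-cases (g ≟ 0ℚ)
    where
    by-cases : Dec (g ≡ 0ℚ) → ∣ g ℚ.* (divq μ (f ℚ.* g) ℚ.* divq b g) ∣ ℚ.≤ divq y f
    by-cases (yes g≡0) = subst (ℚ._≤ divq y f)
      (sym (trans (cong (λ t → ∣ t ℚ.* (divq μ (f ℚ.* t) ℚ.* divq b t) ∣) g≡0)
                  (cong ∣_∣ (ℚP.*-zeroˡ (divq μ (f ℚ.* 0ℚ) ℚ.* divq b 0ℚ)))))
      (divq-nonneg 0≤y (ℚP.<⇒≤ 0<f))
    by-cases (no g≢0) = ℚP.*-cancelʳ-≤-pos f {{ℚ.positive 0<f}} (ℚP.*-cancelʳ-≤-pos g {{ℚ.positive 0<g}} (begin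
      ∣ g ℚ.* (u ℚ.* v) ∣ ℚ.* f ℚ.* g
        ≡⟨ cong₂ (λ s t → ∣ g ℚ.* (u ℚ.* v) ∣ ℚ.* s ℚ.* t) (ℚP.0≤p⇒∣p∣≡p 0≤f) (ℚP.0≤p⇒∣p∣≡p 0≤g) ⟨
      ∣ g ℚ.* (u ℚ.* v) ∣ ℚ.* ∣ f ∣ ℚ.* ∣ g ∣
        ≡⟨ trans (ℚP.∣p*q∣≡∣p∣*∣q∣ (g ℚ.* (u ℚ.* v) ℚ.* f) g) (cong (ℚ._* ∣ g ∣) (ℚP.∣p*q∣≡∣p∣*∣q∣ (g ℚ.* (u ℚ.* v)) f)) ⟨
      ∣ g ℚ.* (u ℚ.* v) ℚ.* f ℚ.* g ∣
        ≡⟨ cong ∣_∣ (solve 4 (λ g u v f → g :* (u :* v) :* f :* g := (u :* (f :* g)) :* (v :* g)) refl g u v f) ⟩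
      ∣ (u ℚ.* (f ℚ.* g)) ℚ.* (v ℚ.* g) ∣
        ≡⟨ cong₂ (λ s t → ∣ s ℚ.* t ∣) (divq-*-cancel μ (f ℚ.* g) fg≢0) (divq-*-cancel b g g≢0) ⟩
      ∣ μ ℚ.* b ∣
        ≡⟨ ℚP.∣p*q∣≡∣p∣*∣q∣ μ b ⟩
      ∣ μ ∣ ℚ.* ∣ b ∣
        ≤⟨ *-monoʳ-≤-nonneg (ℚP.0≤∣p∣ b) ∣μ∣≤1 ⟩
      1ℚ ℚ.* ∣ b ∣
        ≡⟨ ℚP.*-identityˡ ∣ b ∣ ⟩
      ∣ b ∣
        ≤⟨ ∣b∣≤yg ⟩
      y ℚ.* g
        ≡⟨ cong (ℚ._* g) (divq-*-cancel y f f≢0) ⟨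
      divq y f ℚ.* f ℚ.* g
        ∎))
      where
      open ℚP.≤-Reasoning
      open +-*-Solver
      u v : ℚ
      u = divq μ (f ℚ.* g)
      v = divq b g
      0≤f : 0ℚ ℚ.≤ f
      0≤f = ℚP.<⇒≤ 0<f
      0<g : 0ℚ ℚ.< g
      0<g = ≤∧≢⇒< 0≤g (g≢0 ∘ sym)
      f≢0 : f ≢ 0ℚ
      f≢0 = ℚP.<⇒≢ 0<f ∘ sym
      fg≢0 : f ℚ.* g ≢ 0ℚ
      fg≢0 = ℚP.<⇒≢ (ℚP.positive⁻¹ _ {{ℚP.pos*pos⇒pos f {{ℚ.positive 0<f}} g {{ℚ.positive 0<g}}}}) ∘ sym

  divq-power-bound : ∀ e {y f x k} → 0ℚ ℚ.< f → powq y e ℚ.* x ℚ.≤ k ℚ.* powq f e → powq (divq y f) e ℚ.* x ℚ.≤ k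
  divq-power-bound e {y} {f} {x} {k} 0<f yx≤kf = ℚP.*-cancelʳ-≤-pos (powq f e) {{ℚ.positive (powq-pos e 0<f)}} (begin
    powq (divq y f) e ℚ.* x ℚ.* powq f e
      ≡⟨ solve 3 (λ r x F → r :* x :* F := r :* F :* x) refl (powq (divq y f) e) x (powq f e) ⟩
    powq (divq y f) e ℚ.* powq f e ℚ.* x
      ≡⟨ cong (ℚ._* x) (powq-* (divq y f) f e) ⟨
    powq (divq y f ℚ.* f) e ℚ.* x
      ≡⟨ cong (λ t → powq t e ℚ.* x) (divq-*-cancel y f (ℚP.<⇒≢ 0<f ∘ sym)) ⟩
    powq y e ℚ.* x
      ≤⟨ yx≤kf ⟩
    k ℚ.* powq f e
      ∎)
    where
    open ℚP.≤-Reasoning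
    open +-*-Solver

  if-elim : ∀ (P : ℚ → Set) (β : Bool) {x} → (T β → P x) → P 0ℚ → P (if β then x else 0ℚ)
  if-elim P true Px _ = Px tt
  if-elim P false _ P0 = P0

  -- The exponent is suc e₁ so that a vanishing weight makes the left-hand side 0.
  G·w-power-bound : ∀ {z z₀ τ} B L e₁ e₂ (K : ℕ → ℚ) {Kmax} → 0ℚ ℚ.≤ z →
    (∀ {p} → Prime p → B ≤ p → L ≤ p) →
    (∀ q → SquarefreeRough L q → powq (Ξ q) (suc e₁) ℚ.* powq (fromℕ q) e₂ ℚ.≤ K q ℚ.* powq (fromℕ (φ q)) (suc e₁)) →
    (∀ q → K q ℚ.≤ Kmax) → 0ℚ ℚ.≤ Kmax →
    fromℕ B ℚ.≤ z₀ → ∀ q → 1 ≤ q → powq ∣ G τ z z₀ ℚ.* w q z z₀ τ ∣ (suc e₁) ℚ.* powq (fromℕ q) e₂ ℚ.≤ Kmax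
  G·w-power-bound {z} {z₀} {τ} B L e₁ e₂ K {Kmax} 0≤z B⇒L Ξ-bound K≤Kmax 0≤Kmax B≤z₀ q 1≤q =
    if-elim (λ w → powq ∣ G τ z z₀ ℚ.* w ∣ (suc e₁) ℚ.* powq (fromℕ q) e₂ ℚ.≤ Kmax)
      (squarefreeᵇ q ∧ coprimeᵇ q (τ * P z₀)) weight-bound zero-bound
    where
    open ℚP.≤-Reasoning
    instance _ = ℕ.>-nonZero 1≤q
    zero-bound : powq ∣ G τ z z₀ ℚ.* 0ℚ ∣ (suc e₁) ℚ.* powq (fromℕ q) e₂ ℚ.≤ Kmax
    zero-bound = begin
      powq ∣ G τ z z₀ ℚ.* 0ℚ ∣ (suc e₁) ℚ.* powq (fromℕ q) e₂
        ≡⟨ cong (λ t → powq ∣ t ∣ (suc e₁) ℚ.* powq (fromℕ q) e₂) (ℚP.*-zeroʳ (G τ z z₀)) ⟩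
      0ℚ ℚ.* powq 0ℚ e₁ ℚ.* powq (fromℕ q) e₂
        ≡⟨ cong (ℚ._* powq (fromℕ q) e₂) (ℚP.*-zeroˡ (powq 0ℚ e₁)) ⟩
      0ℚ ℚ.* powq (fromℕ q) e₂
        ≡⟨ ℚP.*-zeroˡ (powq (fromℕ q) e₂) ⟩
      0ℚ
        ≤⟨ 0≤Kmax ⟩
      Kmax
        ∎
    weight-bound : T (squarefreeᵇ q ∧ coprimeᵇ q (τ * P z₀)) →
      powq ∣ G τ z z₀ ℚ.* (divq (μ q) (fromℕ (φ q) ℚ.* G τ z z₀) ℚ.* divq (Gbr q z z₀ τ) (G τ z z₀)) ∣ (suc e₁)
        ℚ.* powq (fromℕ q) e₂ ℚ.≤ Kmax
    weight-bound guard = begin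
      powq ∣ G τ z z₀ ℚ.* _ ∣ (suc e₁) ℚ.* powq (fromℕ q) e₂
        ≤⟨ *-monoʳ-≤-nonneg (powq-nonneg e₂ (0≤fromℕ q)) (powq-mono-≤ (suc e₁) (ℚP.0≤∣p∣ _)
             (∣g·μ/fg·b/g∣≤y/f (0<fromℕ-φ q) (G-nonneg τ z z₀) (∣μ∣≤1 q) (∣Gbr∣≤Ξ*G q z z₀ τ 1≤q 0≤z) (Ξ-nonneg q))) ⟩
      powq (divq (Ξ q) (fromℕ (φ q))) (suc e₁) ℚ.* powq (fromℕ q) e₂
        ≤⟨ divq-power-bound (suc e₁) (0<fromℕ-φ q)
             (Ξ-bound q (w-support⇒SquarefreeRough {z₀} {q} {τ} B L B≤z₀ B⇒L 1≤q guard)) ⟩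
      K q
        ≤⟨ K≤Kmax q ⟩
      Kmax
        ∎

open import Defs
open import Data.Nat using (ℕ)
open import Data.Nat.GCD using (gcd)
open import Data.Integer using (+_)
open import Data.Rational using (ℚ; 0ℚ; 1ℚ; _≤_; _/_; _*_; ∣_∣)
open import Data.Product using (_×_; _,_)
open import Relation.Binary.PropositionalEquality using (_≡_; refl)
open import Data.Unit using (tt)
import Data.Rational.Properties as ℚP

lemma13 : (z z₀ : ℚ) (τ : ℕ) → 1ℚ ≤ z → 1 Data.Nat.≤ τ → gcd τ (P z₀) ≡ 1 →
    ((+ 24 / 1 ≤ z₀) → (q : ℕ) → 1 Data.Nat.≤ q →
      powq ∣ G τ z z₀ * w q z z₀ τ ∣ 3 * powq (fromℕ q) 2 ≤ 1ℚ)
    × ((+ 35 / 1 ≤ z₀) → (q : ℕ) → 1 Data.Nat.≤ q →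
      powq ∣ G τ z z₀ * w q z z₀ τ ∣ 10 * powq (fromℕ q) 7 ≤ powq (+ 104 / 100) 10)
lemma13 z z₀ τ 1≤z _ _ =
  G·w-power-bound 24 29 2 2 (λ _ → 1ℚ) 0≤z prime≥24⇒≥29
    (Ξ-power-bound 29 3 2 (λ _ → 1ℚ) ℚP.≤-refl (λ _ → ℚP.≤ᵇ⇒≤ tt) (λ _ _ → refl) local-bound-29)
    (λ _ → ℚP.≤-refl) (ℚP.≤ᵇ⇒≤ tt) ,
  G·w-power-bound 35 37 9 7 K₃₇,₄₁ 0≤z prime≥35⇒≥37
    (Ξ-power-bound 37 10 7 K₃₇,₄₁ (1≤K₃₇,₄₁ 1) K₃₇,₄₁-nonneg K₃₇,₄₁-multiplicative local-bound-37)
    K₃₇,₄₁≤1·04^10 (ℚP.≤ᵇ⇒≤ tt)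
  where
  0≤z : 0ℚ ≤ z
  0≤z = ℚP.≤-trans (ℚP.≤ᵇ⇒≤ tt) 1≤z
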